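{- Let $\pi$ be an $\mathrm{SHA}$-derivation of $\Lambda\mid\Gamma\Rightarrow\delta$ and $n\le|\Lambda|$. Then: (i) $\mathrm{FV}(H_n(\pi))\subseteq\textsc{Var}(\Lambda\upharpoonright n)$; (ii) for all variables $x,y$, $\mathrm{HA}\vdash H_n(\pi), x\le y\Rightarrow H_n(\pi)[x/y]$; (iii) if $|\Lambda|>n$ then $\mathrm{HA}\vdash H_n(\pi), I_{\Lambda\upharpoonright(n+1)}\Rightarrow H_{n+1}(\pi)$.
   Context: Language: terms from variables, $0,S,+,\cdot$; formulas from $s=t,\bot,\wedge,\vee,\to,\forall,\exists$; $\top:=\bot\to\bot$; $x<y:=\exists z.\,y=x+Sz$, $x\le y:=x<Sy$, $\forall x<t.\varphi:=\forall x.(x<t\to\varphi)$, $\forall x\le t.\varphi:=\forall x.(x\le t\to\varphi)$. $\mathrm{HA}$: intuitionistic first-order sequent calculus ($\Gamma\Rightarrow\delta$, $\Gamma$ finite) with weakening, cut, equality rules, axioms $\Rightarrow0\neq St$, $Ss=St\Rightarrow s=t$, $\Rightarrow s+0=s$, $\Rightarrow s+St=S(s+t)$, $\Rightarrow s\cdot0=0$, $\Rightarrow s\cdot St=(s\cdot t)+s$, and induction axioms $\varphi(0),\forall x.\,\varphi(x)\to\varphi(Sx)\Rightarrow\varphi(s)$. Companion labels $x^\bullet\mapsto\Gamma\Rightarrow\delta$ ($x\in\mathrm{FV}(\Gamma,\delta)$, $\bullet\in\{+,-\}$); stacks are finite lists of labels ($\Lambda;\ell$ appends $\ell$ last); $\textsc{Var}(\Lambda)$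 the variables of its labels; $\Lambda\upharpoonright n$ the longest prefix of $\Lambda$ of length $\le n$; $\Lambda^{+x}$ replaces every $x^-$ by $x^+$. For non-empty $\Lambda=\Lambda';(x^\bullet\mapsto\Gamma\Rightarrow\delta)$, with $\vec v$ enumerating $\textsc{Var}(\Lambda)\setminus\{x\}$, $\vec w$ enumerating $\mathrm{FV}(\Gamma,\delta)\setminus(\textsc{Var}(\Lambda)\cup\{x\})$, $\vec u$ fresh: $\widehat{I}_\Lambda:=\forall\vec u\le\vec v.\,\forall\vec w.(\bigwedge\Gamma\to\delta)[\vec u/\vec v]$, and $I_\Lambda:=\forall x'<x.\,\widehat{I}_\Lambda[x'/x]$ if $\bullet=-$, $\forall x'\le x.\,\widehat{I}_\Lambda[x'/x]$ if $\bullet=+$. $\mathrm{SHA}$: sequents $\Lambda\mid\Gamma\Rightarrow\delta$ (well-formed if $\textsc{Var}(\Lambda)\subseteq\mathrm{FV}(\Gamma,\delta)$). Rules: the logical rules of $\mathrm{HA}$ (intuitionistic rules, weakening, cut, $=$L, $=$R, $\bot$L) with the same stack in conclusion and premises (eigenvariables also not in $\Lambda$); Ax and arithmetic axioms with empty stack only; Comp (from $\Lambda;(x^-\mapsto\Gamma\Rightarrow\delta)\mid\Gamma\Rightarrow\delta$ infer $\Lambda\mid\Gamma\Rightarrow\delta$); Bud (axiom $\Lambda;(x^+\mapsto\Gamma\Rightarrow\delta)\mid\Gamma\Rightarrow\delta$); Pop (from $\Lambda\mid\Gamma\Rightarrow\delta$ infer $\Lambda;\Lambda'\mid\Gamma\Rightarrow\delta$);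 $\textsc{Case}_x$ (from $\Lambda\mid\Gamma[0/x]\Rightarrow\delta[0/x]$ and $\Lambda^{+x}\mid\Gamma[Sx/x]\Rightarrow\delta[Sx/x]$ infer $\Lambda\mid\Gamma\Rightarrow\delta$). Derivations are finite trees; all rules except Pop derive only well-formed sequents. For a derivation $\pi$ of $\Lambda\mid\Gamma\Rightarrow\delta$ and $n\le|\Lambda|$, $H_n(\pi)$ is defined recursively: $H_0(\pi):=\top$; for $n>0$: if $\pi$ ends in Bud with conclusion stack $\Lambda$, $H_n(\pi):=I_\Lambda$ if $|\Lambda|=n$ and $\top$ otherwise; if $\pi$ ends in Pop with premise derivation $\pi'$ of $\Lambda_0\mid\Gamma\Rightarrow\delta$, $H_n(\pi):=H_{\min(|\Lambda_0|,n)}(\pi')$; if $\pi$ ends in $\textsc{Case}_x$ with premise derivations $\pi_0,\pi_s$: $H_n(\pi):=\forall x'\le x.\,\big((x'=0\wedge H_n(\pi_0)[x'/x])\vee\exists x''.(x'=Sx''\wedge H_n(\pi_s)[x''/x])\big)$ if $x\in\textsc{Var}(\Lambda\upharpoonright n)$, and $H_n(\pi_0)\wedge H_n(\pi_s)$ otherwise; if $\pi$ ends in any other unary rule (including Comp) with premise derivation $\pi'$, $H_n(\pi):=H_n(\pi')$; any other binary rule with premise derivations $\pi_l,\pi_r$: $H_n(\pi):=H_n(\pi_l)\wedge H_n(\pi_r)$; any other axiom: $\top$. -}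

module Defs where

open import Function using (_∘_)
open import Data.Nat using (ℕ; zero; suc; _⊔_; _⊓_; _≡ᵇ_; _≟_)
open import Data.Fin using (Fin; zero; suc)
open import Data.Bool using (Bool; true; false; if_then_else_)
open import Data.Maybe using (Maybe; just; nothing; maybe)
open import Data.List using (List; []; _∷_; _++_; map; concatMap; foldr; take; length; filter; deduplicate; _∷ʳ_; last)
open import Data.List.Membership.Propositional using (_∈_; _∉_)
open import Data.List.Membership.DecPropositional _≟_ using (_∈?_)
open import Data.List.Relation.Binary.Subset.Propositional using (_⊆_)
open import Relation.Nullary using (does; ¬?)

-- Syntax of first-order arithmetic (locally nameless representation):
-- free variables are named by natural numbers ('var x'); bound
-- variables are de Bruijn indices ('bv i'), well-scoped by the index n
-- (number of binders in scope).

data Tm (n : ℕ) : Set where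
  bv  : Fin n → Tm n
  var : ℕ → Tm n
  𝟎   : Tm n
  S   : Tm n → Tm n
  _⊕_ : Tm n → Tm n → Tm n
  _⊙_ : Tm n → Tm n → Tm n

infix  9 _≐_ _<ᶠ_ _≤ᶠ_
infixr 8 _∧ᶠ_
infixr 7 _∨ᶠ_
infixr 6 _⟶_

data Fm (n : ℕ) : Set where
  _≐_  : Tm n → Tm n → Fm n
  ⊥ᶠ   : Fm n
  _∧ᶠ_ : Fm n → Fm n → Fm n
  _∨ᶠ_ : Fm n → Fm n → Fm n
  _⟶_  : Fm n → Fm n → Fm n
  all  : Fm (suc n) → Fm n
  ex   : Fm (suc n) → Fm n

Term : Set
Term = Tm 0

Formula : Set
Formula = Fm 0

wkT : ∀ {n} → Tm n → Tm (suc n)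
wkT (bv i)  = bv (suc i)
wkT (var x) = var x
wkT 𝟎       = 𝟎
wkT (S t)   = S (wkT t)
wkT (s ⊕ t) = wkT s ⊕ wkT t
wkT (s ⊙ t) = wkT s ⊙ wkT t

subT : ∀ {m n} → (Fin m → Tm n) → (ℕ → Tm n) → Tm m → Tm n
subT σ τ (bv i)  = σ i
subT σ τ (var x) = τ x
subT σ τ 𝟎       = 𝟎
subT σ τ (S t)   = S (subT σ τ t)
subT σ τ (s ⊕ t) = subT σ τ s ⊕ subT σ τ t
subT σ τ (s ⊙ t) = subT σ τ s ⊙ subT σ τ t

lift : ∀ {m n} → (Fin m → Tm n) → Fin (suc m) → Tm (suc n)
lift σ zero    = bv zero
lift σ (suc i) = wkT (σ i)

subF : ∀ {m n} → (Fin m → Tm n) → (ℕ → Tm n) → Fm m → Fm n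
subF σ τ (s ≐ t)  = subT σ τ s ≐ subT σ τ t
subF σ τ ⊥ᶠ       = ⊥ᶠ
subF σ τ (φ ∧ᶠ ψ) = subF σ τ φ ∧ᶠ subF σ τ ψ
subF σ τ (φ ∨ᶠ ψ) = subF σ τ φ ∨ᶠ subF σ τ ψ
subF σ τ (φ ⟶ ψ)  = subF σ τ φ ⟶ subF σ τ ψ
subF σ τ (all φ)  = all (subF (lift σ) (wkT ∘ τ) φ)
subF σ τ (ex φ)   = ex (subF (lift σ) (wkT ∘ τ) φ)

_[_/_] : Formula → Term → ℕ → Formula
φ [ t / x ] = subF bv (λ z → if z ≡ᵇ x then t else var z) φ

_[_/_]* : List Formula → Term → ℕ → List Formula
Γ [ t / x ]* = map (λ φ → φ [ t / x ]) Γ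

close : ℕ → Formula → Fm 1
close x φ = subF (λ ()) (λ z → if z ≡ᵇ x then bv zero else var z) φ

inst : Fm 1 → Term → Formula
inst φ t = subF (λ _ → t) var φ

fvT : ∀ {n} → Tm n → List ℕ
fvT (bv i)  = []
fvT (var x) = x ∷ []
fvT 𝟎       = []
fvT (S t)   = fvT t
fvT (s ⊕ t) = fvT s ++ fvT t
fvT (s ⊙ t) = fvT s ++ fvT t

FV : ∀ {n} → Fm n → List ℕ
FV (s ≐ t)  = fvT s ++ fvT t
FV ⊥ᶠ       = []
FV (φ ∧ᶠ ψ) = FV φ ++ FV ψ
FV (φ ∨ᶠ ψ) = FV φ ++ FV ψ
FV (φ ⟶ ψ)  = FV φ ++ FV ψ
FV (all φ)  = FV φ
FV (ex φ)   = FV φ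

FVs : List Formula → Formula → List ℕ
FVs Γ δ = concatMap FV Γ ++ FV δ

fresh : List ℕ → ℕ
fresh xs = suc (foldr _⊔_ 0 xs)

⊤ᶠ : ∀ {n} → Fm n
⊤ᶠ = ⊥ᶠ ⟶ ⊥ᶠ

-- s < t := ∃z. t = s + Sz
_<ᶠ_ : ∀ {n} → Tm n → Tm n → Fm n
s <ᶠ t = ex (wkT t ≐ (wkT s ⊕ S (bv zero)))

_≤ᶠ_ : ∀ {n} → Tm n → Tm n → Fm n
s ≤ᶠ t = s <ᶠ S t

∀[_]_ : ℕ → Formula → Formula
∀[ x ] φ = all (close x φ)

∃[_]_ : ℕ → Formula → Formula
∃[ x ] φ = ex (close x φ)

∀<[_]_ : ℕ → Formula → Formula
∀<[ x ] φ = let x' = fresh (x ∷ FV φ) in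
            ∀[ x' ] ((var x' <ᶠ var x) ⟶ φ [ var x' / x ])

∀≤[_]_ : ℕ → Formula → Formula
∀≤[ x ] φ = let x' = fresh (x ∷ FV φ) in
            ∀[ x' ] ((var x' ≤ᶠ var x) ⟶ φ [ var x' / x ])

⋀ : List Formula → Formula
⋀ []           = ⊤ᶠ
⋀ (φ ∷ [])     = φ
⋀ (φ ∷ ψ ∷ Γ)  = φ ∧ᶠ ⋀ (ψ ∷ Γ)

-- HA: intuitionistic sequent calculus for arithmetic, Γ ⇒ δ
-- (Γ a finite list; weakening is w.r.t. list inclusion, so exchange and
-- contraction are included).

data HA : List Formula → Formula → Set where
  ax   : ∀ {Γ φ} → φ ∈ Γ → HA Γ φ
  wk   : ∀ {Γ Δ δ} → Γ ⊆ Δ → HA Γ δ → HA Δ δ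
  cut  : ∀ {Γ φ δ} → HA Γ φ → HA (φ ∷ Γ) δ → HA Γ δ
  ⊥L   : ∀ {Γ δ} → HA (⊥ᶠ ∷ Γ) δ
  ∧R   : ∀ {Γ φ ψ} → HA Γ φ → HA Γ ψ → HA Γ (φ ∧ᶠ ψ)
  ∧L   : ∀ {Γ φ ψ δ} → HA (φ ∷ ψ ∷ Γ) δ → HA (φ ∧ᶠ ψ ∷ Γ) δ
  ∨R₁  : ∀ {Γ φ ψ} → HA Γ φ → HA Γ (φ ∨ᶠ ψ)
  ∨R₂  : ∀ {Γ φ ψ} → HA Γ ψ → HA Γ (φ ∨ᶠ ψ)
  ∨L   : ∀ {Γ φ ψ δ} → HA (φ ∷ Γ) δ → HA (ψ ∷ Γ) δ → HA (φ ∨ᶠ ψ ∷ Γ) δ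
  ⟶R   : ∀ {Γ φ ψ} → HA (φ ∷ Γ) ψ → HA Γ (φ ⟶ ψ)
  ⟶L   : ∀ {Γ φ ψ δ} → HA Γ φ → HA (ψ ∷ Γ) δ → HA (φ ⟶ ψ ∷ Γ) δ
  ∀R   : ∀ {Γ φ e} → e ∉ FVs Γ (all φ) → HA Γ (inst φ (var e)) → HA Γ (all φ)
  ∀L   : ∀ {Γ φ δ} (t : Term) → HA (inst φ t ∷ Γ) δ → HA (all φ ∷ Γ) δ
  ∃R   : ∀ {Γ φ} (t : Term) → HA Γ (inst φ t) → HA Γ (ex φ)
  ∃L   : ∀ {Γ φ δ e} → e ∉ FVs (ex φ ∷ Γ) δ → HA (inst φ (var e) ∷ Γ) δ → HA (ex φ ∷ Γ) δ
  =R   : ∀ {Γ} (t : Term) → HA Γ (t ≐ t)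
  =L   : ∀ {Γ δ s t x} → HA (Γ [ s / x ]*) (δ [ s / x ])
         → HA ((s ≐ t) ∷ Γ [ t / x ]*) (δ [ t / x ])
  ax0S : ∀ (t : Term) → HA [] ((𝟎 ≐ S t) ⟶ ⊥ᶠ)
  axSS : ∀ (s t : Term) → HA ((S s ≐ S t) ∷ []) (s ≐ t)
  ax+0 : ∀ (s : Term) → HA [] ((s ⊕ 𝟎) ≐ s)
  ax+S : ∀ (s t : Term) → HA [] ((s ⊕ S t) ≐ S (s ⊕ t))
  ax·0 : ∀ (s : Term) → HA [] ((s ⊙ 𝟎) ≐ 𝟎)
  ax·S : ∀ (s t : Term) → HA [] ((s ⊙ S t) ≐ ((s ⊙ t) ⊕ s))
  ind  : ∀ (φ : Formula) (x : ℕ) (s : Term)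
         → HA (φ [ 𝟎 / x ] ∷ ∀[ x ] (φ ⟶ φ [ S (var x) / x ]) ∷ []) (φ [ s / x ])

data Sign : Set where
  ⁺ ⁻ : Sign

record Label : Set where
  constructor label
  field
    lvar  : ℕ
    sign  : Sign
    lctx  : List Formula
    lgoal : Formula
    valid : lvar ∈ FVs lctx lgoal

open Label public

Stack : Set
Stack = List Label

Var : Stack → List ℕ
Var Λ = map lvar Λ

_↾_ : Stack → ℕ → Stack
Λ ↾ n = take n Λ

plus : ℕ → Label → Label
plus x (label y ⁻ Γ δ p) = if y ≡ᵇ x then label y ⁺ Γ δ p else label y ⁻ Γ δ p
plus x ℓ = ℓ

_⁺[_] : Stack → ℕ → Stack
Λ ⁺[ x ] = map (plus x) Λ

Îhat : Stack → Label → Formula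
Îhat Λ (label x _ Γ δ _) =
  foldr ∀≤[_]_ (foldr ∀[_]_ (⋀ Γ ⟶ δ) ws) vs
  where
  vs : List ℕ
  vs = deduplicate _≟_ (filter (λ z → ¬? (z ≟ x)) (Var Λ))
  ws : List ℕ
  ws = deduplicate _≟_ (filter (λ z → ¬? (z ∈? Var Λ)) (filter (λ z → ¬? (z ≟ x)) (FVs Γ δ)))

Iof : Stack → Label → Formula
Iof Λ ℓ@(label x ⁻ _ _ _) = ∀<[ x ] Îhat Λ ℓ
Iof Λ ℓ@(label x ⁺ _ _ _) = ∀≤[ x ] Îhat Λ ℓ

-- I_Λ (only meaningful for non-empty Λ; ⊤ for the empty stack)
I : Stack → Formula
I Λ = maybe (Iof Λ) ⊤ᶠ (last Λ)

WF : Stack → List Formula → Formula → Set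
WF Λ Γ δ = Var Λ ⊆ FVs Γ δ

data SHA : Stack → List Formula → Formula → Set where
  ax   : ∀ {Γ φ} → φ ∈ Γ → SHA [] Γ φ
  ax0S : ∀ (t : Term) → SHA [] [] ((𝟎 ≐ S t) ⟶ ⊥ᶠ)
  axSS : ∀ (s t : Term) → SHA [] ((S s ≐ S t) ∷ []) (s ≐ t)
  ax+0 : ∀ (s : Term) → SHA [] [] ((s ⊕ 𝟎) ≐ s)
  ax+S : ∀ (s t : Term) → SHA [] [] ((s ⊕ S t) ≐ S (s ⊕ t))
  ax·0 : ∀ (s : Term) → SHA [] [] ((s ⊙ 𝟎) ≐ 𝟎)
  ax·S : ∀ (s t : Term) → SHA [] [] ((s ⊙ S t) ≐ ((s ⊙ t) ⊕ s))
  wk   : ∀ {Λ Γ Δ δ} → WF Λ Δ δ → Γ ⊆ Δ → SHA Λ Γ δ → SHA Λ Δ δ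
  cut  : ∀ {Λ Γ φ δ} → WF Λ Γ δ → SHA Λ Γ φ → SHA Λ (φ ∷ Γ) δ → SHA Λ Γ δ
  ⊥L   : ∀ {Λ Γ δ} → WF Λ (⊥ᶠ ∷ Γ) δ → SHA Λ (⊥ᶠ ∷ Γ) δ
  ∧R   : ∀ {Λ Γ φ ψ} → WF Λ Γ (φ ∧ᶠ ψ) → SHA Λ Γ φ → SHA Λ Γ ψ → SHA Λ Γ (φ ∧ᶠ ψ)
  ∧L   : ∀ {Λ Γ φ ψ δ} → WF Λ (φ ∧ᶠ ψ ∷ Γ) δ → SHA Λ (φ ∷ ψ ∷ Γ) δ → SHA Λ (φ ∧ᶠ ψ ∷ Γ) δ
  ∨R₁  : ∀ {Λ Γ φ ψ} → WF Λ Γ (φ ∨ᶠ ψ) → SHA Λ Γ φ → SHA Λ Γ (φ ∨ᶠ ψ)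
  ∨R₂  : ∀ {Λ Γ φ ψ} → WF Λ Γ (φ ∨ᶠ ψ) → SHA Λ Γ ψ → SHA Λ Γ (φ ∨ᶠ ψ)
  ∨L   : ∀ {Λ Γ φ ψ δ} → WF Λ (φ ∨ᶠ ψ ∷ Γ) δ → SHA Λ (φ ∷ Γ) δ → SHA Λ (ψ ∷ Γ) δ
         → SHA Λ (φ ∨ᶠ ψ ∷ Γ) δ
  ⟶R   : ∀ {Λ Γ φ ψ} → WF Λ Γ (φ ⟶ ψ) → SHA Λ (φ ∷ Γ) ψ → SHA Λ Γ (φ ⟶ ψ)
  ⟶L   : ∀ {Λ Γ φ ψ δ} → WF Λ (φ ⟶ ψ ∷ Γ) δ → SHA Λ Γ φ → SHA Λ (ψ ∷ Γ) δ
         → SHA Λ (φ ⟶ ψ ∷ Γ) δ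
  ∀R   : ∀ {Λ Γ φ e} → WF Λ Γ (all φ) → e ∉ FVs Γ (all φ) → e ∉ Var Λ
         → SHA Λ Γ (inst φ (var e)) → SHA Λ Γ (all φ)
  ∀L   : ∀ {Λ Γ φ δ} (t : Term) → WF Λ (all φ ∷ Γ) δ → SHA Λ (inst φ t ∷ Γ) δ
         → SHA Λ (all φ ∷ Γ) δ
  ∃R   : ∀ {Λ Γ φ} (t : Term) → WF Λ Γ (ex φ) → SHA Λ Γ (inst φ t) → SHA Λ Γ (ex φ)
  ∃L   : ∀ {Λ Γ φ δ e} → WF Λ (ex φ ∷ Γ) δ → e ∉ FVs (ex φ ∷ Γ) δ → e ∉ Var Λ
         → SHA Λ (inst φ (var e) ∷ Γ) δ → SHA Λ (ex φ ∷ Γ) δ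
  =R   : ∀ {Λ Γ} (t : Term) → WF Λ Γ (t ≐ t) → SHA Λ Γ (t ≐ t)
  =L   : ∀ {Λ Γ δ s t x} → WF Λ ((s ≐ t) ∷ Γ [ t / x ]*) (δ [ t / x ])
         → SHA Λ (Γ [ s / x ]*) (δ [ s / x ])
         → SHA Λ ((s ≐ t) ∷ Γ [ t / x ]*) (δ [ t / x ])
  comp : ∀ {Λ Γ δ x} (p : x ∈ FVs Γ δ) → WF Λ Γ δ
         → SHA (Λ ∷ʳ label x ⁻ Γ δ p) Γ δ → SHA Λ Γ δ
  bud  : ∀ {Λ Γ δ x} (p : x ∈ FVs Γ δ) → WF (Λ ∷ʳ label x ⁺ Γ δ p) Γ δ
         → SHA (Λ ∷ʳ label x ⁺ Γ δ p) Γ δ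
  pop  : ∀ {Λ Γ δ} (Λ' : Stack) → SHA Λ Γ δ → SHA (Λ ++ Λ') Γ δ
  case : ∀ {Λ Γ δ} (x : ℕ) → WF Λ Γ δ
         → SHA Λ (Γ [ 𝟎 / x ]*) (δ [ 𝟎 / x ])
         → SHA (Λ ⁺[ x ]) (Γ [ S (var x) / x ]*) (δ [ S (var x) / x ])
         → SHA Λ Γ δ

caseFm : ℕ → Formula → Formula → Formula
caseFm x A B =
  let x'  = fresh (x ∷ FV A ++ FV B)
      x'' = fresh (x' ∷ x ∷ FV A ++ FV B)
  in ∀[ x' ] ((var x' ≤ᶠ var x) ⟶
       (((var x' ≐ 𝟎) ∧ᶠ A [ var x' / x ])
        ∨ᶠ ∃[ x'' ] ((var x' ≐ S (var x'')) ∧ᶠ B [ var x'' / x ])))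

H : ∀ {Λ Γ δ} → ℕ → SHA Λ Γ δ → Formula
H zero π = ⊤ᶠ
H (suc k) (ax _) = ⊤ᶠ
H (suc k) (ax0S _) = ⊤ᶠ
H (suc k) (axSS _ _) = ⊤ᶠ
H (suc k) (ax+0 _) = ⊤ᶠ
H (suc k) (ax+S _ _) = ⊤ᶠ
H (suc k) (ax·0 _) = ⊤ᶠ
H (suc k) (ax·S _ _) = ⊤ᶠ
H (suc k) (wk _ _ π) = H (suc k) π
H (suc k) (cut _ π₁ π₂) = H (suc k) π₁ ∧ᶠ H (suc k) π₂
H (suc k) (⊥L _) = ⊤ᶠ
H (suc k) (∧R _ π₁ π₂) = H (suc k) π₁ ∧ᶠ H (suc k) π₂
H (suc k) (∧L _ π) = H (suc k) π
H (suc k) (∨R₁ _ π) = H (suc k) π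
H (suc k) (∨R₂ _ π) = H (suc k) π
H (suc k) (∨L _ π₁ π₂) = H (suc k) π₁ ∧ᶠ H (suc k) π₂
H (suc k) (⟶R _ π) = H (suc k) π
H (suc k) (⟶L _ π₁ π₂) = H (suc k) π₁ ∧ᶠ H (suc k) π₂
H (suc k) (∀R _ _ _ π) = H (suc k) π
H (suc k) (∀L _ _ π) = H (suc k) π
H (suc k) (∃R _ _ π) = H (suc k) π
H (suc k) (∃L _ _ _ π) = H (suc k) π
H (suc k) (=R _ _) = ⊤ᶠ
H (suc k) (=L _ π) = H (suc k) π
H (suc k) (comp _ _ π) = H (suc k) π
H (suc k) (bud {Λ} {Γ} {δ} {x} p _) =
  let Λ⁺ = Λ ∷ʳ label x ⁺ Γ δ p in
  if length Λ⁺ ≡ᵇ suc k then I Λ⁺ else ⊤ᶠ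
H (suc k) (pop {Λ₀} _ π) = H (length Λ₀ ⊓ suc k) π
H (suc k) (case {Λ} x _ π₀ πₛ) =
  if does (x ∈? Var (Λ ↾ suc k))
  then caseFm x (H (suc k) π₀) (H (suc k) πₛ)
  else (H (suc k) π₀ ∧ᶠ H (suc k) πₛ)

-- For (ii), the bounded quantifiers ∀x'<x and ∀x'≤x of I_Λ
-- are downward closed in their bound x by transitivity of ≤, and ⊤, ∧, ∀, the bounded quantifiers
-- and the case formula preserve downward closure in every variable.  For (iii) the only real case
-- is Case_x with x among the first n+1 stack variables: in the zero branch, I_{Λ↾(n+1)} is lowered
-- from x to x' by (ii); in the successor branch, whose stack is Λ^{+x}, the bound Sx'' ≤ x turns
-- I_{Λ↾(n+1)}, a quantifier over values < x or ≤ x, into I_{(Λ↾(n+1))^{+x}}[x''/x], a quantifier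
-- over values ≤ x''.

module Submission where

open import Defs
open import Function using (_∘_)
open import Data.Nat using (ℕ; zero; suc; _⊔_; _⊓_; _≡ᵇ_; _≟_; _≤_; _<_; _≤?_; s≤s)
open import Data.Nat.Properties
  using (≤-refl; ≤-reflexive; ≤-trans; m≤m+n; <⇒≤; ≰⇒>; n≤1+n; m≤m⊔n; m≤n⊔m; <-irrefl;
         m⊓n≤m; m⊓n≤n; ⊓-zeroʳ; m≤n⇒m⊓n≡m; m≥n⇒m⊓n≡n)
open import Data.Fin using (Fin; zero; suc)
open import Data.Bool using (true; false; if_then_else_)
open import Data.Maybe using (just; nothing; maybe)
import Data.Maybe as Maybe
open import Data.List using (List; []; _∷_; _++_; map; concatMap; foldr; take; length; filter; deduplicate; last; _∷ʳ_)
open import Data.List.Properties using (++-identityʳ; length-map; length-++; take-map; take-all; last-map; map-∘; map-cong)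
open import Data.List.Relation.Unary.Any using (here; there)
open import Data.List.Membership.Propositional using (_∈_; _∉_)
open import Data.List.Membership.Propositional.Properties
  using (∈-++⁻; ∈-++⁺ˡ; ∈-++⁺ʳ; ∈-map⁺; ∈-map⁻; ∈-filter⁺; ∈-filter⁻; ∈-deduplicate⁺; ∈-deduplicate⁻)
open import Data.List.Membership.DecPropositional _≟_ using (_∈?_)
open import Data.List.Relation.Binary.Subset.Propositional using (_⊆_)
open import Data.Sum using (_⊎_; inj₁; inj₂; [_,_]′; map₁) renaming (map to map⊎)
open import Data.Product using (Σ; _×_; _,_; proj₁; proj₂)
open import Data.Empty using (⊥-elim)
open import Relation.Nullary using (¬_; Dec; yes; no; does; ¬?)
open import Relation.Binary.PropositionalEquality

≡ᵇ-refl : ∀ n → (n ≡ᵇ n) ≡ true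
≡ᵇ-refl zero    = refl
≡ᵇ-refl (suc n) = ≡ᵇ-refl n

≢⇒≡ᵇ-false : ∀ {m n} → m ≢ n → (m ≡ᵇ n) ≡ false
≢⇒≡ᵇ-false {zero}  {zero}  m≢n = ⊥-elim (m≢n refl)
≢⇒≡ᵇ-false {zero}  {suc n} m≢n = refl
≢⇒≡ᵇ-false {suc m} {zero}  m≢n = refl
≢⇒≡ᵇ-false {suc m} {suc n} m≢n = ≢⇒≡ᵇ-false (m≢n ∘ cong suc)

≡ᵇ-false⇒≢ : ∀ {m n} → (m ≡ᵇ n) ≡ false → m ≢ n
≡ᵇ-false⇒≢ {m} eq refl with trans (sym eq) (≡ᵇ-refl m)
... | ()

fresh∉ : ∀ xs → fresh xs ∉ xs
fresh∉ xs p = <-irrefl refl (s≤s (≤-max xs p))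
  where
  ≤-max : ∀ {x} xs → x ∈ xs → x ≤ foldr _⊔_ 0 xs
  ≤-max (y ∷ ys) (here refl) = m≤m⊔n y _
  ≤-max (y ∷ ys) (there p)   = ≤-trans (≤-max ys p) (m≤n⊔m y _)

fresh≢ : ∀ {x} xs → x ∈ xs → x ≢ fresh xs
fresh≢ xs p refl = fresh∉ xs p

upd : ∀ {n} → (ℕ → Tm n) → ℕ → Tm n → ℕ → Tm n
upd τ v t z = if z ≡ᵇ v then t else τ z

upd-same : ∀ {n} (τ : ℕ → Tm n) v t → upd τ v t v ≡ t
upd-same τ v t rewrite ≡ᵇ-refl v = refl

upd-other : ∀ {n} (τ : ℕ → Tm n) v t {z} → z ≢ v → upd τ v t z ≡ τ z
upd-other τ v t z≢v rewrite ≢⇒≡ᵇ-false z≢v = refl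

substF : (ℕ → Term) → Formula → Formula
substF = subF bv

infix 4 _≗ᶠ_

_≗ᶠ_ : ∀ {m n} → (Fin m → Tm n) → (Fin m → Tm n) → Set
σ ≗ᶠ σ' = ∀ i → σ i ≡ σ' i

Agree : ∀ {n} → List ℕ → (ℕ → Tm n) → (ℕ → Tm n) → Set
Agree xs τ τ' = ∀ z → z ∈ xs → τ z ≡ τ' z

lift-cong : ∀ {m n} {σ σ' : Fin m → Tm n} → σ ≗ᶠ σ' → lift σ ≗ᶠ lift σ'
lift-cong eq zero    = refl
lift-cong eq (suc i) = cong wkT (eq i)

subT-cong : ∀ {m n} {σ σ' : Fin m → Tm n} {τ τ' : ℕ → Tm n} →
  σ ≗ᶠ σ' → ∀ t → Agree (fvT t) τ τ' → subT σ τ t ≡ subT σ' τ' t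
subT-cong σ≗σ' (bv i)  eq = σ≗σ' i
subT-cong σ≗σ' (var x) eq = eq x (here refl)
subT-cong σ≗σ' 𝟎       eq = refl
subT-cong σ≗σ' (S t)   eq = cong S (subT-cong σ≗σ' t eq)
subT-cong σ≗σ' (s ⊕ t) eq = cong₂ _⊕_ (subT-cong σ≗σ' s (λ z → eq z ∘ ∈-++⁺ˡ)) (subT-cong σ≗σ' t (λ z → eq z ∘ ∈-++⁺ʳ (fvT s)))
subT-cong σ≗σ' (s ⊙ t) eq = cong₂ _⊙_ (subT-cong σ≗σ' s (λ z → eq z ∘ ∈-++⁺ˡ)) (subT-cong σ≗σ' t (λ z → eq z ∘ ∈-++⁺ʳ (fvT s)))

subF-cong : ∀ {m n} {σ σ' : Fin m → Tm n} {τ τ' : ℕ → Tm n} →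
  σ ≗ᶠ σ' → ∀ φ → Agree (FV φ) τ τ' → subF σ τ φ ≡ subF σ' τ' φ
subF-cong σ≗σ' (s ≐ t)  eq = cong₂ _≐_ (subT-cong σ≗σ' s (λ z → eq z ∘ ∈-++⁺ˡ)) (subT-cong σ≗σ' t (λ z → eq z ∘ ∈-++⁺ʳ (fvT s)))
subF-cong σ≗σ' ⊥ᶠ       eq = refl
subF-cong σ≗σ' (φ ∧ᶠ ψ) eq = cong₂ _∧ᶠ_ (subF-cong σ≗σ' φ (λ z → eq z ∘ ∈-++⁺ˡ)) (subF-cong σ≗σ' ψ (λ z → eq z ∘ ∈-++⁺ʳ (FV φ)))
subF-cong σ≗σ' (φ ∨ᶠ ψ) eq = cong₂ _∨ᶠ_ (subF-cong σ≗σ' φ (λ z → eq z ∘ ∈-++⁺ˡ)) (subF-cong σ≗σ' ψ (λ z → eq z ∘ ∈-++⁺ʳ (FV φ)))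
subF-cong σ≗σ' (φ ⟶ ψ)  eq = cong₂ _⟶_ (subF-cong σ≗σ' φ (λ z → eq z ∘ ∈-++⁺ˡ)) (subF-cong σ≗σ' ψ (λ z → eq z ∘ ∈-++⁺ʳ (FV φ)))
subF-cong σ≗σ' (all φ)  eq = cong all (subF-cong (lift-cong σ≗σ') φ (λ z → cong wkT ∘ eq z))
subF-cong σ≗σ' (ex φ)   eq = cong ex (subF-cong (lift-cong σ≗σ') φ (λ z → cong wkT ∘ eq z))

subT-lift-wkT : ∀ {m n} (σ : Fin m → Tm n) τ t → subT (lift σ) (wkT ∘ τ) (wkT t) ≡ wkT (subT σ τ t)
subT-lift-wkT σ τ (bv i)  = refl
subT-lift-wkT σ τ (var x) = refl
subT-lift-wkT σ τ 𝟎       = refl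
subT-lift-wkT σ τ (S t)   = cong S (subT-lift-wkT σ τ t)
subT-lift-wkT σ τ (s ⊕ t) = cong₂ _⊕_ (subT-lift-wkT σ τ s) (subT-lift-wkT σ τ t)
subT-lift-wkT σ τ (s ⊙ t) = cong₂ _⊙_ (subT-lift-wkT σ τ s) (subT-lift-wkT σ τ t)

subT-∘ : ∀ {k m n} (σ₁ : Fin k → Tm m) τ₁ (σ₂ : Fin m → Tm n) τ₂ t →
  subT σ₂ τ₂ (subT σ₁ τ₁ t) ≡ subT (subT σ₂ τ₂ ∘ σ₁) (subT σ₂ τ₂ ∘ τ₁) t
subT-∘ σ₁ τ₁ σ₂ τ₂ (bv i)  = refl
subT-∘ σ₁ τ₁ σ₂ τ₂ (var x) = refl
subT-∘ σ₁ τ₁ σ₂ τ₂ 𝟎       = refl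
subT-∘ σ₁ τ₁ σ₂ τ₂ (S t)   = cong S (subT-∘ σ₁ τ₁ σ₂ τ₂ t)
subT-∘ σ₁ τ₁ σ₂ τ₂ (s ⊕ t) = cong₂ _⊕_ (subT-∘ σ₁ τ₁ σ₂ τ₂ s) (subT-∘ σ₁ τ₁ σ₂ τ₂ t)
subT-∘ σ₁ τ₁ σ₂ τ₂ (s ⊙ t) = cong₂ _⊙_ (subT-∘ σ₁ τ₁ σ₂ τ₂ s) (subT-∘ σ₁ τ₁ σ₂ τ₂ t)

lift-∘ : ∀ {k m n} (σ₁ : Fin k → Tm m) (σ₂ : Fin m → Tm n) τ₂ →
  subT (lift σ₂) (wkT ∘ τ₂) ∘ lift σ₁ ≗ᶠ lift (subT σ₂ τ₂ ∘ σ₁)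
lift-∘ σ₁ σ₂ τ₂ zero    = refl
lift-∘ σ₁ σ₂ τ₂ (suc i) = subT-lift-wkT σ₂ τ₂ (σ₁ i)

subF-∘ : ∀ {k m n} (σ₁ : Fin k → Tm m) τ₁ (σ₂ : Fin m → Tm n) τ₂ φ →
  subF σ₂ τ₂ (subF σ₁ τ₁ φ) ≡ subF (subT σ₂ τ₂ ∘ σ₁) (subT σ₂ τ₂ ∘ τ₁) φ
subF-∘ σ₁ τ₁ σ₂ τ₂ (s ≐ t)  = cong₂ _≐_ (subT-∘ σ₁ τ₁ σ₂ τ₂ s) (subT-∘ σ₁ τ₁ σ₂ τ₂ t)
subF-∘ σ₁ τ₁ σ₂ τ₂ ⊥ᶠ       = refl
subF-∘ σ₁ τ₁ σ₂ τ₂ (φ ∧ᶠ ψ) = cong₂ _∧ᶠ_ (subF-∘ σ₁ τ₁ σ₂ τ₂ φ) (subF-∘ σ₁ τ₁ σ₂ τ₂ ψ)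
subF-∘ σ₁ τ₁ σ₂ τ₂ (φ ∨ᶠ ψ) = cong₂ _∨ᶠ_ (subF-∘ σ₁ τ₁ σ₂ τ₂ φ) (subF-∘ σ₁ τ₁ σ₂ τ₂ ψ)
subF-∘ σ₁ τ₁ σ₂ τ₂ (φ ⟶ ψ)  = cong₂ _⟶_ (subF-∘ σ₁ τ₁ σ₂ τ₂ φ) (subF-∘ σ₁ τ₁ σ₂ τ₂ ψ)
subF-∘ σ₁ τ₁ σ₂ τ₂ (all φ)  = cong all (trans (subF-∘ (lift σ₁) (wkT ∘ τ₁) (lift σ₂) (wkT ∘ τ₂) φ)
  (subF-cong (lift-∘ σ₁ σ₂ τ₂) φ (λ z _ → subT-lift-wkT σ₂ τ₂ (τ₁ z))))
subF-∘ σ₁ τ₁ σ₂ τ₂ (ex φ)   = cong ex (trans (subF-∘ (lift σ₁) (wkT ∘ τ₁) (lift σ₂) (wkT ∘ τ₂) φ)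
  (subF-cong (lift-∘ σ₁ σ₂ τ₂) φ (λ z _ → subT-lift-wkT σ₂ τ₂ (τ₁ z))))

subT-id : ∀ {n} (t : Tm n) → subT bv var t ≡ t
subT-id (bv i)  = refl
subT-id (var x) = refl
subT-id 𝟎       = refl
subT-id (S t)   = cong S (subT-id t)
subT-id (s ⊕ t) = cong₂ _⊕_ (subT-id s) (subT-id t)
subT-id (s ⊙ t) = cong₂ _⊙_ (subT-id s) (subT-id t)

lift-bv : ∀ {n} → lift {n} bv ≗ᶠ bv
lift-bv zero    = refl
lift-bv (suc i) = refl

subF-id : ∀ {n} (φ : Fm n) → subF bv var φ ≡ φ
subF-id (s ≐ t)  = cong₂ _≐_ (subT-id s) (subT-id t)
subF-id ⊥ᶠ       = refl
subF-id (φ ∧ᶠ ψ) = cong₂ _∧ᶠ_ (subF-id φ) (subF-id ψ)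
subF-id (φ ∨ᶠ ψ) = cong₂ _∨ᶠ_ (subF-id φ) (subF-id ψ)
subF-id (φ ⟶ ψ)  = cong₂ _⟶_ (subF-id φ) (subF-id ψ)
subF-id (all φ)  = cong all (trans (subF-cong lift-bv φ (λ _ _ → refl)) (subF-id φ))
subF-id (ex φ)   = cong ex (trans (subF-cong lift-bv φ (λ _ _ → refl)) (subF-id φ))

subT-wkT : ∀ {m n} (σ : Fin (suc m) → Tm n) τ t → subT σ τ (wkT t) ≡ subT (σ ∘ suc) τ t
subT-wkT σ τ (bv i)  = refl
subT-wkT σ τ (var x) = refl
subT-wkT σ τ 𝟎       = refl
subT-wkT σ τ (S t)   = cong S (subT-wkT σ τ t)
subT-wkT σ τ (s ⊕ t) = cong₂ _⊕_ (subT-wkT σ τ s) (subT-wkT σ τ t)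
subT-wkT σ τ (s ⊙ t) = cong₂ _⊙_ (subT-wkT σ τ s) (subT-wkT σ τ t)

substF-∘ : ∀ τ₁ τ₂ φ → substF τ₂ (substF τ₁ φ) ≡ substF (subT bv τ₂ ∘ τ₁) φ
substF-∘ τ₁ τ₂ φ = subF-∘ bv τ₁ bv τ₂ φ

substF-cong : ∀ {τ τ'} φ → Agree (FV φ) τ τ' → substF τ φ ≡ substF τ' φ
substF-cong = subF-cong (λ ())

substF-id : ∀ {τ} φ → Agree (FV φ) τ var → substF τ φ ≡ φ
substF-id φ eq = trans (substF-cong φ eq) (subF-id φ)

[/]-∉FV : ∀ φ t {y} → y ∉ FV φ → φ [ t / y ] ≡ φ
[/]-∉FV φ t y∉φ = substF-id φ (λ z z∈φ → upd-other var _ t (λ { refl → y∉φ z∈φ }))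

upd-shadow : ∀ {n} (τ : ℕ → Tm n) x s t z → upd (upd τ x s) x t z ≡ upd τ x t z
upd-shadow τ x s t z with z ≡ᵇ x
... | true  = refl
... | false = refl

upd-var-self : ∀ v z → upd {0} var v (var v) z ≡ var z
upd-var-self v z with z ≟ v
... | yes refl = upd-same var v (var v)
... | no z≢v   = upd-other var v (var v) z≢v

subF-close : ∀ t τ v φ → subF (λ _ → t) τ (close v φ) ≡ substF (upd τ v t) φ
subF-close t τ v φ = trans (subF-∘ (λ ()) _ (λ _ → t) τ φ) (subF-cong (λ ()) φ agree)
  where
  agree : Agree (FV φ) (subT (λ _ → t) τ ∘ (λ z → if z ≡ᵇ v then bv zero else var z)) (upd τ v t)
  agree z _ with z ≡ᵇ v
  ... | true  = refl
  ... | false = refl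

inst-close : ∀ v φ t → inst (close v φ) t ≡ φ [ t / v ]
inst-close v φ t = subF-close t var v φ

inst-close-var : ∀ v φ → inst (close v φ) (var v) ≡ φ
inst-close-var v φ = trans (inst-close v φ (var v)) (substF-id φ (λ z _ → upd-var-self v z))

-- the left-hand side is the body of  substF τ (∀[ v ] φ)  instantiated at t
inst-substF-close : ∀ τ v φ t → inst (subF (lift bv) (wkT ∘ τ) (close v φ)) t ≡ substF (upd τ v t) φ
inst-substF-close τ v φ t =
  trans (subF-∘ (lift bv) (wkT ∘ τ) (λ _ → t) var (close v φ))
        (trans (subF-cong pointwise (close v φ) (λ z _ → wkT-inst (τ z))) (subF-close t τ v φ))
  where
  pointwise : subT (λ _ → t) var ∘ lift bv ≗ᶠ (λ _ → t)
  pointwise zero = refl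
  pointwise (suc ())
  wkT-inst : ∀ u → subT (λ _ → t) var (wkT u) ≡ u
  wkT-inst u = trans (subT-wkT (λ _ → t) var u) (trans (subT-cong (λ ()) u (λ _ _ → refl)) (subT-id u))

≤ᶠ-subF : ∀ {m n} (σ : Fin m → Tm n) τ s u → subF σ τ (s ≤ᶠ u) ≡ (subT σ τ s ≤ᶠ subT σ τ u)
≤ᶠ-subF σ τ s u = cong ex (cong₂ _≐_ (subT-lift-wkT σ τ (S u)) (cong (_⊕ S (bv zero)) (subT-lift-wkT σ τ s)))

<ᶠ-subF : ∀ {m n} (σ : Fin m → Tm n) τ s u → subF σ τ (s <ᶠ u) ≡ (subT σ τ s <ᶠ subT σ τ u)
<ᶠ-subF σ τ s u = cong ex (cong₂ _≐_ (subT-lift-wkT σ τ u) (cong (_⊕ S (bv zero)) (subT-lift-wkT σ τ s)))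

substF-rename : ∀ τ x X t φ → X ∉ FV φ → substF (upd τ X t) (φ [ var X / x ]) ≡ substF (upd τ x t) φ
substF-rename τ x X t φ X∉φ = trans (substF-∘ _ _ φ) (substF-cong φ agree)
  where
  agree : Agree (FV φ) (subT bv (upd τ X t) ∘ upd var x (var X)) (upd τ x t)
  agree w w∈φ with w ≟ x
  ... | yes refl rewrite ≡ᵇ-refl w | ≡ᵇ-refl X = refl
  ... | no w≢x rewrite ≢⇒≡ᵇ-false w≢x | ≢⇒≡ᵇ-false {w} {X} (λ { refl → X∉φ w∈φ }) = refl

[/]-[/]-upd : ∀ φ v e y a → e ≢ y → φ [ var e / v ] [ var a / y ] ≡ substF (upd (upd var y (var a)) v (var e)) φ
[/]-[/]-upd φ v e y a e≢y = trans (substF-∘ _ _ φ) (substF-cong φ agree)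
  where
  agree : Agree (FV φ) (subT bv (upd var y (var a)) ∘ upd var v (var e)) (upd (upd var y (var a)) v (var e))
  agree w _ with w ≟ v
  ... | yes refl rewrite ≡ᵇ-refl w | ≢⇒≡ᵇ-false e≢y = refl
  ... | no w≢v rewrite ≢⇒≡ᵇ-false w≢v = refl

substF-upd-shadow : ∀ φ x a e → substF (upd (upd var x (var a)) x (var e)) φ ≡ φ [ var e / x ]
substF-upd-shadow φ x a e = substF-cong φ (λ z _ → upd-shadow var x (var a) (var e) z)

fvT-wkT : ∀ {n} (t : Tm n) → fvT (wkT t) ≡ fvT t
fvT-wkT (bv i)  = refl
fvT-wkT (var x) = refl
fvT-wkT 𝟎       = refl
fvT-wkT (S t)   = fvT-wkT t
fvT-wkT (s ⊕ t) = cong₂ _++_ (fvT-wkT s) (fvT-wkT t)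
fvT-wkT (s ⊙ t) = cong₂ _++_ (fvT-wkT s) (fvT-wkT t)

FVOrigin : ∀ {m n} → (Fin m → Tm n) → (ℕ → Tm n) → List ℕ → ℕ → Set
FVOrigin {m} σ τ xs z = (Σ (Fin m) λ i → z ∈ fvT (σ i)) ⊎ (Σ ℕ λ w → w ∈ xs × z ∈ fvT (τ w))

module _ {m n} (σ : Fin m → Tm n) (τ : ℕ → Tm n) where

  FVOrigin-++ˡ : ∀ {xs} ys {z} → FVOrigin σ τ xs z → FVOrigin σ τ (xs ++ ys) z
  FVOrigin-++ˡ ys (inj₁ o)           = inj₁ o
  FVOrigin-++ˡ ys (inj₂ (w , w∈ , p)) = inj₂ (w , ∈-++⁺ˡ w∈ , p)

  FVOrigin-++ʳ : ∀ xs {ys z} → FVOrigin σ τ ys z → FVOrigin σ τ (xs ++ ys) z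
  FVOrigin-++ʳ xs (inj₁ o)           = inj₁ o
  FVOrigin-++ʳ xs (inj₂ (w , w∈ , p)) = inj₂ (w , ∈-++⁺ʳ xs w∈ , p)

  FVOrigin-++ : ∀ xs {ys z} → FVOrigin σ τ xs z ⊎ FVOrigin σ τ ys z → FVOrigin σ τ (xs ++ ys) z
  FVOrigin-++ xs {ys} = [ FVOrigin-++ˡ ys , FVOrigin-++ʳ xs ]′

  FVOrigin-lift : ∀ {xs z} → FVOrigin (lift σ) (wkT ∘ τ) xs z → FVOrigin σ τ xs z
  FVOrigin-lift (inj₁ (zero , ()))
  FVOrigin-lift (inj₁ (suc i , p))    = inj₁ (i , subst (_ ∈_) (fvT-wkT (σ i)) p)
  FVOrigin-lift (inj₂ (w , w∈ , p))   = inj₂ (w , w∈ , subst (_ ∈_) (fvT-wkT (τ w)) p)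

fv-subT : ∀ {m n} (σ : Fin m → Tm n) τ t {z} → z ∈ fvT (subT σ τ t) → FVOrigin σ τ (fvT t) z
fv-subT σ τ (bv i)  p = inj₁ (i , p)
fv-subT σ τ (var x) p = inj₂ (x , here refl , p)
fv-subT σ τ 𝟎       ()
fv-subT σ τ (S t)   p = fv-subT σ τ t p
fv-subT σ τ (s ⊕ t) p = FVOrigin-++ σ τ (fvT s) (map⊎ (fv-subT σ τ s) (fv-subT σ τ t) (∈-++⁻ _ p))
fv-subT σ τ (s ⊙ t) p = FVOrigin-++ σ τ (fvT s) (map⊎ (fv-subT σ τ s) (fv-subT σ τ t) (∈-++⁻ _ p))

fv-subF : ∀ {m n} (σ : Fin m → Tm n) τ φ {z} → z ∈ FV (subF σ τ φ) → FVOrigin σ τ (FV φ) z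
fv-subF σ τ (s ≐ t)  p = FVOrigin-++ σ τ (fvT s) (map⊎ (fv-subT σ τ s) (fv-subT σ τ t) (∈-++⁻ _ p))
fv-subF σ τ ⊥ᶠ       ()
fv-subF σ τ (φ ∧ᶠ ψ) p = FVOrigin-++ σ τ (FV φ) (map⊎ (fv-subF σ τ φ) (fv-subF σ τ ψ) (∈-++⁻ _ p))
fv-subF σ τ (φ ∨ᶠ ψ) p = FVOrigin-++ σ τ (FV φ) (map⊎ (fv-subF σ τ φ) (fv-subF σ τ ψ) (∈-++⁻ _ p))
fv-subF σ τ (φ ⟶ ψ)  p = FVOrigin-++ σ τ (FV φ) (map⊎ (fv-subF σ τ φ) (fv-subF σ τ ψ) (∈-++⁻ _ p))
fv-subF σ τ (all φ)  p = FVOrigin-lift σ τ (fv-subF (lift σ) (wkT ∘ τ) φ p)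
fv-subF σ τ (ex φ)   p = FVOrigin-lift σ τ (fv-subF (lift σ) (wkT ∘ τ) φ p)

fv-close : ∀ v φ {z} → z ∈ FV (close v φ) → z ∈ FV φ × z ≢ v
fv-close v φ p with fv-subF (λ ()) (λ z → if z ≡ᵇ v then bv zero else var z) φ p
... | inj₁ (() , _)
... | inj₂ (w , w∈φ , q) with w ≡ᵇ v in eq
fv-close v φ p | inj₂ (w , w∈φ , ()) | true
fv-close v φ p | inj₂ (w , w∈φ , here refl) | false = w∈φ , ≡ᵇ-false⇒≢ eq

fv-[/] : ∀ φ t v {z} → z ∈ FV (φ [ t / v ]) → (z ∈ FV φ × z ≢ v) ⊎ z ∈ fvT t
fv-[/] φ t v p with fv-subF bv (upd var v t) φ p
... | inj₁ (() , _)
... | inj₂ (w , w∈φ , q) with w ≟ v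
... | yes refl = inj₂ (subst (_ ∈_) (cong fvT (upd-same var v t)) q)
... | no w≢v with subst (_ ∈_) (cong fvT (upd-other var v t w≢v)) q
... | here refl = inj₁ (w∈φ , w≢v)

⊤-intro : ∀ {Γ} → HA Γ ⊤ᶠ
⊤-intro = ⟶R ⊥L

cast : ∀ {Γ φ ψ} → φ ≡ ψ → HA Γ φ → HA Γ ψ
cast refl d = d

castˡ : ∀ {Γ Δ φ} → Γ ≡ Δ → HA Γ φ → HA Δ φ
castˡ refl d = d

hyp₀ : ∀ {A Γ} → HA (A ∷ Γ) A
hyp₀ = ax (here refl)

hyp₁ : ∀ {A B Γ} → HA (B ∷ A ∷ Γ) A
hyp₁ = ax (there (here refl))

hyp₂ : ∀ {A B C Γ} → HA (C ∷ B ∷ A ∷ Γ) A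
hyp₂ = ax (there (there (here refl)))

hyp₃ : ∀ {A B C D Γ} → HA (D ∷ C ∷ B ∷ A ∷ Γ) A
hyp₃ = ax (there (there (there (here refl))))

hyp₄ : ∀ {A B C D E Γ} → HA (E ∷ D ∷ C ∷ B ∷ A ∷ Γ) A
hyp₄ = ax (there (there (there (there (here refl)))))

weaken₁ : ∀ {A Γ φ} → HA Γ φ → HA (A ∷ Γ) φ
weaken₁ = wk there

⟶E : ∀ {Γ A B} → HA Γ (A ⟶ B) → HA Γ A → HA Γ B
⟶E d a = cut d (⟶L a hyp₀)

∧E₁ : ∀ {Γ A B} → HA Γ (A ∧ᶠ B) → HA Γ A
∧E₁ d = cut d (∧L hyp₀)

∧E₂ : ∀ {Γ A B} → HA Γ (A ∧ᶠ B) → HA Γ B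
∧E₂ d = cut d (∧L hyp₁)

∨E : ∀ {Γ A B C} → HA Γ (A ∨ᶠ B) → HA (A ∷ Γ) C → HA (B ∷ Γ) C → HA Γ C
∨E d l r = cut d (∨L l r)

∀E : ∀ {Γ B} → HA Γ (all B) → (t : Term) → HA Γ (inst B t)
∀E d t = cut d (∀L t hyp₀)

cut₂ : ∀ {Γ P Q R} → HA (P ∷ Q ∷ []) R → HA Γ P → HA Γ Q → HA Γ R
cut₂ d p q = cut p (cut (weaken₁ q) (wk swap d))
  where
  swap : ∀ {A B : Formula} {Γ x} → x ∈ A ∷ B ∷ [] → x ∈ B ∷ A ∷ Γ
  swap (here refl)         = there (here refl)
  swap (there (here refl)) = here refl

∀I-fresh : ∀ {Γ B} avoid → (∀ e → e ∉ FVs Γ (all B) → e ∉ avoid → HA Γ (inst B (var e))) → HA Γ (all B)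
∀I-fresh {Γ} {B} avoid k = ∀R (fresh∉ all-vars ∘ ∈-++⁺ˡ) (k e (fresh∉ all-vars ∘ ∈-++⁺ˡ) (fresh∉ all-vars ∘ ∈-++⁺ʳ _))
  where
  all-vars = FVs Γ (all B) ++ avoid
  e = fresh all-vars

∃E-fresh : ∀ {Γ B δ} avoid → HA Γ (ex B) →
  (∀ e → e ∉ FVs (ex B ∷ Γ) δ → e ∉ avoid → HA (inst B (var e) ∷ Γ) δ) → HA Γ δ
∃E-fresh {Γ} {B} {δ} avoid d k = cut d (∃L (fresh∉ all-vars ∘ ∈-++⁺ˡ) (k e (fresh∉ all-vars ∘ ∈-++⁺ˡ) (fresh∉ all-vars ∘ ∈-++⁺ʳ _)))
  where
  all-vars = FVs (ex B ∷ Γ) δ ++ avoid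
  e = fresh all-vars

-- closure of HA under substitution: discharge the context, generalise, instantiate, undischarge

_⟶*_ : List Formula → Formula → Formula
[]      ⟶* φ = φ
(γ ∷ Γ) ⟶* φ = γ ⟶ (Γ ⟶* φ)

⟶R* : ∀ Γ {Δ φ} → HA (Γ ++ Δ) φ → HA Δ (Γ ⟶* φ)
⟶R* []      d = d
⟶R* (γ ∷ Γ) {Δ} d = ⟶R (⟶R* Γ (wk (move-out Γ) d))
  where
  move-out : ∀ Γ {x} → x ∈ (γ ∷ Γ) ++ Δ → x ∈ Γ ++ γ ∷ Δ
  move-out Γ (here refl) = ∈-++⁺ʳ Γ (here refl)
  move-out Γ (there p)   = [ ∈-++⁺ˡ , ∈-++⁺ʳ Γ ∘ there ]′ (∈-++⁻ Γ p)

⟶L* : ∀ Γ {Δ φ} → HA Δ (Γ ⟶* φ) → HA (Γ ++ Δ) φ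
⟶L* []      d = d
⟶L* (γ ∷ Γ) {Δ} d = wk (move-in Γ) (⟶L* Γ (⟶E (weaken₁ d) hyp₀))
  where
  move-in : ∀ Γ {x} → x ∈ Γ ++ γ ∷ Δ → x ∈ (γ ∷ Γ) ++ Δ
  move-in Γ p with ∈-++⁻ Γ p
  ... | inj₁ q         = there (∈-++⁺ˡ q)
  ... | inj₂ (here q)  = here q
  ... | inj₂ (there q) = there (∈-++⁺ʳ Γ q)

⟶*-[/] : ∀ Γ φ t x → (Γ ⟶* φ) [ t / x ] ≡ (Γ [ t / x ]*) ⟶* (φ [ t / x ])
⟶*-[/] []      φ t x = refl
⟶*-[/] (γ ∷ Γ) φ t x = cong (γ [ t / x ] ⟶_) (⟶*-[/] Γ φ t x)

∀I-closed : ∀ {φ} x → HA [] φ → HA [] (∀[ x ] φ)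
∀I-closed {φ} x d = ∀R (λ p → proj₂ (fv-close x φ p) refl) (cast (sym (inst-close-var x φ)) d)

HA-[/] : ∀ {Γ φ} t x → HA Γ φ → HA (Γ [ t / x ]*) (φ [ t / x ])
HA-[/] {Γ} {φ} t x d =
  castˡ (++-identityʳ _) (⟶L* (Γ [ t / x ]*) (cast (⟶*-[/] Γ φ t x)
    (cast (inst-close x _ t) (∀E (∀I-closed x (⟶R* Γ (castˡ (sym (++-identityʳ Γ)) d))) t))))

-- instantiating the free variables of a closed theorem, one after the other
∀* : List ℕ → Formula → Formula
∀* []       φ = φ
∀* (x ∷ xs) φ = ∀[ x ] ∀* xs φ

∀*-intro : ∀ {φ} xs → HA [] φ → HA [] (∀* xs φ)
∀*-intro []       d = d
∀*-intro (x ∷ xs) d = ∀I-closed x (∀*-intro xs d)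

upd* : (ℕ → Term) → List (ℕ × Term) → ℕ → Term
upd* τ []            = τ
upd* τ ((x , t) ∷ ρ) = upd* (upd τ x t) ρ

∀*-elim : ∀ {Γ φ} τ ρ → HA Γ (substF τ (∀* (map proj₁ ρ) φ)) → HA Γ (substF (upd* τ ρ) φ)
∀*-elim τ []                  d = d
∀*-elim {φ = φ} τ ((x , t) ∷ ρ) d =
  ∀*-elim (upd τ x t) ρ (cast (inst-substF-close τ x (∀* (map proj₁ ρ) φ) t) (∀E d t))

instantiate : ∀ {Γ φ} → HA [] φ → ∀ ρ → HA Γ (substF (upd* var ρ) φ)
instantiate d ρ = wk (λ ()) (∀*-elim var ρ (cast (sym (subF-id _)) (∀*-intro (map proj₁ ρ) d)))

private
  v : ∀ {n} → ℕ → Tm n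
  v = var

⊢≐-sym : HA [] ((v 0 ≐ v 1) ⟶ (v 1 ≐ v 0))
⊢≐-sym = ⟶R (=L {Γ = []} {δ = v 2 ≐ v 0} {x = 2} (=R (v 0)))

⊢≐-trans : HA [] ((v 0 ≐ v 1) ⟶ (v 1 ≐ v 2) ⟶ (v 0 ≐ v 2))
⊢≐-trans = ⟶R (⟶R (=L {Γ = (v 0 ≐ v 1) ∷ []} {δ = v 0 ≐ v 3} {x = 3} hyp₀))

⊢≐-congS : HA [] ((v 0 ≐ v 1) ⟶ (S (v 0) ≐ S (v 1)))
⊢≐-congS = ⟶R (=L {Γ = []} {δ = S (v 0) ≐ S (v 3)} {x = 3} (=R _))

⊢≐-cong⊕ˡ : HA [] ((v 0 ≐ v 1) ⟶ ((v 0 ⊕ v 2) ≐ (v 1 ⊕ v 2)))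
⊢≐-cong⊕ˡ = ⟶R (=L {Γ = []} {δ = (v 0 ⊕ v 2) ≐ (v 3 ⊕ v 2)} {x = 3} (=R _))

⊢≐-cong⊕ʳ : HA [] ((v 0 ≐ v 1) ⟶ ((v 2 ⊕ v 0) ≐ (v 2 ⊕ v 1)))
⊢≐-cong⊕ʳ = ⟶R (=L {Γ = []} {δ = (v 2 ⊕ v 0) ≐ (v 2 ⊕ v 3)} {x = 3} (=R _))

module _ {Γ : List Formula} where

  ≐-sym : ∀ {s t} → HA Γ (s ≐ t) → HA Γ (t ≐ s)
  ≐-sym {s} {t} = ⟶E (instantiate ⊢≐-sym ((0 , s) ∷ (1 , t) ∷ []))

  ≐-trans : ∀ {s} t {u} → HA Γ (s ≐ t) → HA Γ (t ≐ u) → HA Γ (s ≐ u)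
  ≐-trans {s} t {u} d = ⟶E (⟶E (instantiate ⊢≐-trans ((0 , s) ∷ (1 , t) ∷ (2 , u) ∷ [])) d)

  ≐-congS : ∀ {s t} → HA Γ (s ≐ t) → HA Γ (S s ≐ S t)
  ≐-congS {s} {t} = ⟶E (instantiate ⊢≐-congS ((0 , s) ∷ (1 , t) ∷ []))

  ≐-cong⊕ˡ : ∀ {s t} u → HA Γ (s ≐ t) → HA Γ ((s ⊕ u) ≐ (t ⊕ u))
  ≐-cong⊕ˡ {s} {t} u = ⟶E (instantiate ⊢≐-cong⊕ˡ ((0 , s) ∷ (1 , t) ∷ (2 , u) ∷ []))

  ≐-cong⊕ʳ : ∀ {s t} u → HA Γ (s ≐ t) → HA Γ ((u ⊕ s) ≐ (u ⊕ t))
  ≐-cong⊕ʳ {s} {t} u = ⟶E (instantiate ⊢≐-cong⊕ʳ ((0 , s) ∷ (1 , t) ∷ (2 , u) ∷ []))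

  ⊕-identityʳ : ∀ s → HA Γ ((s ⊕ 𝟎) ≐ s)
  ⊕-identityʳ s = wk (λ ()) (ax+0 s)

  ⊕-suc : ∀ s t → HA Γ ((s ⊕ S t) ≐ S (s ⊕ t))
  ⊕-suc s t = wk (λ ()) (ax+S s t)

  S-injective : ∀ {s t} → HA Γ (S s ≐ S t) → HA Γ (s ≐ t)
  S-injective {s} {t} d = cut d (wk (λ { (here refl) → here refl }) (axSS s t))

⊢⊕-sucˡ : HA [] ((S (v 0) ⊕ v 1) ≐ S (v 0 ⊕ v 1))
⊢⊕-sucˡ = cut₂ (ind ((S (v 0) ⊕ v 1) ≐ S (v 0 ⊕ v 1)) 1 (v 1)) base step
  where
  base : HA [] ((S (v 0) ⊕ 𝟎) ≐ S (v 0 ⊕ 𝟎))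
  base = ≐-trans (S (v 0)) (⊕-identityʳ _) (≐-congS (≐-sym (⊕-identityʳ _)))
  step : HA [] (∀[ 1 ] (((S (v 0) ⊕ v 1) ≐ S (v 0 ⊕ v 1)) ⟶ ((S (v 0) ⊕ S (v 1)) ≐ S (v 0 ⊕ S (v 1)))))
  step = ∀I-fresh [] λ e _ _ → ⟶R (≐-trans (S (S (v 0) ⊕ var e)) (⊕-suc _ _)
           (≐-trans (S (S (v 0 ⊕ var e))) (≐-congS hyp₀) (≐-congS (≐-sym (⊕-suc _ _)))))

⊢⊕-assoc : HA [] (((v 0 ⊕ v 1) ⊕ v 2) ≐ (v 0 ⊕ (v 1 ⊕ v 2)))
⊢⊕-assoc = cut₂ (ind (((v 0 ⊕ v 1) ⊕ v 2) ≐ (v 0 ⊕ (v 1 ⊕ v 2))) 2 (v 2)) base step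
  where
  base : HA [] (((v 0 ⊕ v 1) ⊕ 𝟎) ≐ (v 0 ⊕ (v 1 ⊕ 𝟎)))
  base = ≐-trans (v 0 ⊕ v 1) (⊕-identityʳ _) (≐-cong⊕ʳ (v 0) (≐-sym (⊕-identityʳ _)))
  step : HA [] (∀[ 2 ] ((((v 0 ⊕ v 1) ⊕ v 2) ≐ (v 0 ⊕ (v 1 ⊕ v 2))) ⟶ (((v 0 ⊕ v 1) ⊕ S (v 2)) ≐ (v 0 ⊕ (v 1 ⊕ S (v 2))))))
  step = ∀I-fresh [] λ e _ _ → ⟶R (≐-trans (S ((v 0 ⊕ v 1) ⊕ var e)) (⊕-suc _ _)
           (≐-trans (S (v 0 ⊕ (v 1 ⊕ var e))) (≐-congS hyp₀)
           (≐-trans (v 0 ⊕ S (v 1 ⊕ var e)) (≐-sym (⊕-suc _ _)) (≐-cong⊕ʳ (v 0) (≐-sym (⊕-suc _ _))))))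

module _ {Γ : List Formula} where

  ⊕-sucˡ : ∀ a b → HA Γ ((S a ⊕ b) ≐ S (a ⊕ b))
  ⊕-sucˡ a b = instantiate ⊢⊕-sucˡ ((0 , a) ∷ (1 , b) ∷ [])

  ⊕-assoc : ∀ a b c → HA Γ (((a ⊕ b) ⊕ c) ≐ (a ⊕ (b ⊕ c)))
  ⊕-assoc a b c = instantiate ⊢⊕-assoc ((0 , a) ∷ (1 , b) ∷ (2 , c) ∷ [])

  S≐⊕S⇒≐⊕ : ∀ {a b z} → HA Γ (S b ≐ (a ⊕ S z)) → HA Γ (b ≐ (a ⊕ z))
  S≐⊕S⇒≐⊕ {a} {b} {z} d = S-injective (≐-trans (a ⊕ S z) d (⊕-suc a z))

⊢≤-trans : HA [] ((v 0 ≤ᶠ v 1) ⟶ (v 1 ≤ᶠ v 2) ⟶ (v 0 ≤ᶠ v 2))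
⊢≤-trans = ⟶R (⟶R (∃E-fresh [] hyp₁ λ z₁ _ _ → ∃E-fresh [] hyp₁ λ z₂ _ _ →
  ∃R (var z₁ ⊕ var z₂)
    (≐-trans (S (v 1 ⊕ var z₂)) (≐-trans (v 1 ⊕ S (var z₂)) hyp₀ (⊕-suc _ _))
    (≐-trans (S ((v 0 ⊕ var z₁) ⊕ var z₂)) (≐-congS (≐-cong⊕ˡ (var z₂) (S≐⊕S⇒≐⊕ hyp₁)))
    (≐-trans (S (v 0 ⊕ (var z₁ ⊕ var z₂))) (≐-congS (⊕-assoc _ _ _)) (≐-sym (⊕-suc _ _)))))))

⊢<-≤-trans : HA [] ((v 0 <ᶠ v 1) ⟶ (v 1 ≤ᶠ v 2) ⟶ (v 0 <ᶠ v 2))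
⊢<-≤-trans = ⟶R (⟶R (∃E-fresh [] hyp₁ λ z₁ _ _ → ∃E-fresh [] hyp₁ λ z₂ _ _ →
  ∃R (var z₁ ⊕ var z₂)
    (≐-trans (v 1 ⊕ var z₂) (S≐⊕S⇒≐⊕ hyp₀)
    (≐-trans ((v 0 ⊕ S (var z₁)) ⊕ var z₂) (≐-cong⊕ˡ (var z₂) hyp₁)
    (≐-trans (v 0 ⊕ (S (var z₁) ⊕ var z₂)) (⊕-assoc _ _ _) (≐-cong⊕ʳ (v 0) (⊕-sucˡ _ _)))))))

⊢≤-S≤⇒< : HA [] ((v 0 ≤ᶠ v 1) ⟶ (S (v 1) ≤ᶠ v 2) ⟶ (v 0 <ᶠ v 2))
⊢≤-S≤⇒< = ⟶R (⟶R (∃E-fresh [] hyp₁ λ z₁ _ _ → ∃E-fresh [] hyp₁ λ z₂ _ _ →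
  ∃R (var z₁ ⊕ var z₂)
    (≐-trans (S (v 1) ⊕ var z₂) (S≐⊕S⇒≐⊕ hyp₀)
    (≐-trans (S (v 1 ⊕ var z₂)) (⊕-sucˡ _ _)
    (≐-trans (S ((v 0 ⊕ var z₁) ⊕ var z₂)) (≐-congS (≐-cong⊕ˡ (var z₂) (S≐⊕S⇒≐⊕ hyp₁)))
    (≐-trans (S (v 0 ⊕ (var z₁ ⊕ var z₂))) (≐-congS (⊕-assoc _ _ _)) (≐-sym (⊕-suc _ _))))))))

⊢<⇒≤ : HA [] ((v 0 <ᶠ v 1) ⟶ (v 0 ≤ᶠ v 1))
⊢<⇒≤ = ⟶R (∃E-fresh [] hyp₀ λ z _ _ → ∃R (S (var z))
  (≐-trans (S (v 0 ⊕ S (var z))) (≐-congS hyp₀) (≐-sym (⊕-suc _ _))))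

⊢≤-refl : HA [] (v 0 ≤ᶠ v 0)
⊢≤-refl = ∃R 𝟎 (≐-sym (≐-trans (S (v 0 ⊕ 𝟎)) (⊕-suc _ _) (≐-congS (⊕-identityʳ _))))

⊢≤-respˡ-≐ : HA [] ((v 0 ≤ᶠ v 2) ⟶ (v 0 ≐ v 1) ⟶ (v 1 ≤ᶠ v 2))
⊢≤-respˡ-≐ = ⟶R (⟶R (=L {Γ = (v 0 ≤ᶠ v 2) ∷ []} {δ = v 3 ≤ᶠ v 2} {x = 3} hyp₀))

⊢zero-or-suc : HA [] ((v 0 ≐ 𝟎) ∨ᶠ ex (v 0 ≐ S (bv zero)))
⊢zero-or-suc = cut₂ (ind ((v 0 ≐ 𝟎) ∨ᶠ ex (v 0 ≐ S (bv zero))) 0 (v 0))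
  (∨R₁ (=R 𝟎)) (∀I-fresh [] λ e _ _ → ⟶R (∨R₂ (∃R (var e) (=R _))))

module _ {Γ : List Formula} where

  ≤ᶠ-trans : ∀ {a b c} → HA Γ (a ≤ᶠ b) → HA Γ (b ≤ᶠ c) → HA Γ (a ≤ᶠ c)
  ≤ᶠ-trans {a} {b} {c} d = ⟶E (⟶E (instantiate ⊢≤-trans ((0 , a) ∷ (1 , b) ∷ (2 , c) ∷ [])) d)

  <ᶠ-≤ᶠ-trans : ∀ {a b c} → HA Γ (a <ᶠ b) → HA Γ (b ≤ᶠ c) → HA Γ (a <ᶠ c)
  <ᶠ-≤ᶠ-trans {a} {b} {c} d = ⟶E (⟶E (instantiate ⊢<-≤-trans ((0 , a) ∷ (1 , b) ∷ (2 , c) ∷ [])) d)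

  ≤ᶠ-S≤ᶠ⇒<ᶠ : ∀ {a b c} → HA Γ (a ≤ᶠ b) → HA Γ (S b ≤ᶠ c) → HA Γ (a <ᶠ c)
  ≤ᶠ-S≤ᶠ⇒<ᶠ {a} {b} {c} d = ⟶E (⟶E (instantiate ⊢≤-S≤⇒< ((0 , a) ∷ (1 , b) ∷ (2 , c) ∷ [])) d)

  <ᶠ⇒≤ᶠ : ∀ {a b} → HA Γ (a <ᶠ b) → HA Γ (a ≤ᶠ b)
  <ᶠ⇒≤ᶠ {a} {b} = ⟶E (instantiate ⊢<⇒≤ ((0 , a) ∷ (1 , b) ∷ []))

  ≤ᶠ-refl : ∀ a → HA Γ (a ≤ᶠ a)
  ≤ᶠ-refl a = instantiate ⊢≤-refl ((0 , a) ∷ [])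

  ≤ᶠ-S≤ᶠ⇒≤ᶠ : ∀ {a b c} → HA Γ (a ≤ᶠ b) → HA Γ (S b ≤ᶠ c) → HA Γ (a ≤ᶠ c)
  ≤ᶠ-S≤ᶠ⇒≤ᶠ a≤b Sb≤c = <ᶠ⇒≤ᶠ (≤ᶠ-S≤ᶠ⇒<ᶠ a≤b Sb≤c)

  S≤ᶠ⇒≤ᶠ : ∀ {b c} → HA Γ (S b ≤ᶠ c) → HA Γ (b ≤ᶠ c)
  S≤ᶠ⇒≤ᶠ {b} = ≤ᶠ-S≤ᶠ⇒≤ᶠ (≤ᶠ-refl b)

  ≤ᶠ-respˡ-≐ : ∀ {a b c} → HA Γ (a ≤ᶠ c) → HA Γ (a ≐ b) → HA Γ (b ≤ᶠ c)
  ≤ᶠ-respˡ-≐ {a} {b} {c} d = ⟶E (⟶E (instantiate ⊢≤-respˡ-≐ ((0 , a) ∷ (1 , b) ∷ (2 , c) ∷ [])) d)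

  zero-or-suc : ∀ a → HA Γ ((a ≐ 𝟎) ∨ᶠ ex (wkT a ≐ S (bv zero)))
  zero-or-suc a = instantiate ⊢zero-or-suc ((0 , a) ∷ [])

DownClosed : ℕ → Formula → Set
DownClosed y φ = ∀ a → HA (φ ∷ (var a ≤ᶠ var y) ∷ []) (φ [ var a / y ])

lower : ∀ {Γ y φ a} → DownClosed y φ → HA Γ φ → HA Γ (var a ≤ᶠ var y) → HA Γ (φ [ var a / y ])
lower {a = a} down = cut₂ (down a)

downClosed-∉FV : ∀ {y φ} → y ∉ FV φ → DownClosed y φ
downClosed-∉FV {y} {φ} y∉φ a = cast (sym ([/]-∉FV φ (var a) y∉φ)) hyp₀

downClosed-⊤ : ∀ {y} → DownClosed y ⊤ᶠ
downClosed-⊤ = downClosed-∉FV (λ ())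

downClosed-∧ : ∀ {y φ ψ} → DownClosed y φ → DownClosed y ψ → DownClosed y (φ ∧ᶠ ψ)
downClosed-∧ down-φ down-ψ a = ∧L (∧R (lower down-φ hyp₀ hyp₂) (lower down-ψ hyp₁ hyp₂))

-- lowering y goes through a fresh z, since a may coincide with v
downClosed-rename : ∀ {y φ v e} → DownClosed y φ → v ≢ y → e ≢ y → DownClosed y (φ [ var e / v ])
downClosed-rename {y} {φ} {v} {e} down v≢y e≢y a = cast reorder (castˡ context (HA-[/] (var a) z (HA-[/] (var e) v (down z))))
  where
  avoid = y ∷ v ∷ e ∷ FV φ
  z = fresh avoid
  z≢y : z ≢ y
  z≢y = ≢-sym (fresh≢ avoid (here refl))
  z≢v : z ≢ v
  z≢v = ≢-sym (fresh≢ avoid (there (here refl)))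
  z≢e : z ≢ e
  z≢e = ≢-sym (fresh≢ avoid (there (there (here refl))))
  z∉φ : z ∉ FV φ
  z∉φ = fresh∉ avoid ∘ there ∘ there ∘ there
  z∉φ[e/v] : z ∉ FV (φ [ var e / v ])
  z∉φ[e/v] p with fv-[/] φ (var e) v p
  ... | inj₁ (z∈φ , _) = z∉φ z∈φ
  ... | inj₂ (here z≡e) = z≢e z≡e
  bound : (var z ≤ᶠ var y) [ var e / v ] [ var a / z ] ≡ (var a ≤ᶠ var y)
  bound = trans (cong (_[ var a / z ]) ([/]-∉FV (var z ≤ᶠ var y) (var e) v∉))
                (trans (≤ᶠ-subF bv (upd var z (var a)) (var z) (var y)) (cong₂ _≤ᶠ_ (upd-same var z (var a)) (upd-other var z (var a) (≢-sym z≢y))))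
    where
    v∉ : v ∉ FV (var {0} z ≤ᶠ var y)
    v∉ (here v≡y)         = v≢y v≡y
    v∉ (there (here v≡z)) = z≢v (sym v≡z)
  context : (φ [ var e / v ] [ var a / z ]) ∷ ((var z ≤ᶠ var y) [ var e / v ] [ var a / z ]) ∷ []
          ≡ φ [ var e / v ] ∷ (var a ≤ᶠ var y) ∷ []
  context = cong₂ _∷_ ([/]-∉FV _ (var a) z∉φ[e/v]) (cong (_∷ []) bound)
  agree : Agree (FV φ) (λ w → subT bv (upd var z (var a)) (subT bv (upd var v (var e)) (upd var y (var z) w)))
                       (λ w → subT bv (upd var y (var a)) (upd var v (var e) w))
  agree w w∈φ with w ≟ y
  ... | yes refl rewrite ≡ᵇ-refl w | ≢⇒≡ᵇ-false z≢v | ≡ᵇ-refl z | ≢⇒≡ᵇ-false (≢-sym v≢y) | ≡ᵇ-refl w = refl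
  ... | no w≢y with w ≟ v
  ...   | yes refl rewrite ≢⇒≡ᵇ-false w≢y | ≡ᵇ-refl w | ≢⇒≡ᵇ-false (≢-sym z≢e) | ≢⇒≡ᵇ-false e≢y = refl
  ...   | no w≢v rewrite ≢⇒≡ᵇ-false w≢y | ≢⇒≡ᵇ-false w≢v | ≢⇒≡ᵇ-false {w} {z} (λ { refl → z∉φ w∈φ }) | ≢⇒≡ᵇ-false w≢y = refl
  reorder : φ [ var z / y ] [ var e / v ] [ var a / z ] ≡ φ [ var e / v ] [ var a / y ]
  reorder = begin
    φ [ var z / y ] [ var e / v ] [ var a / z ]
      ≡⟨ cong (substF _) (substF-∘ _ _ φ) ⟩
    substF (upd var z (var a)) (substF _ φ)
      ≡⟨ substF-∘ _ _ φ ⟩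
    substF _ φ
      ≡⟨ substF-cong φ agree ⟩
    substF (subT bv (upd var y (var a)) ∘ upd var v (var e)) φ
      ≡⟨ sym (substF-∘ _ _ φ) ⟩
    φ [ var e / v ] [ var a / y ] ∎
    where open ≡-Reasoning

downClosed-∀ : ∀ {y v φ} → DownClosed y φ → v ≢ y → DownClosed y (∀[ v ] φ)
downClosed-∀ {y} {v} {φ} down v≢y a = ∀I-fresh (y ∷ []) λ e _ e∉y →
  cast (sym (inst-substF-close (upd var y (var a)) v φ (var e)))
    (cast ([/]-[/]-upd φ v e y a (e∉y ∘ here))
      (lower (downClosed-rename down v≢y (e∉y ∘ here)) (cast (inst-close v φ (var e)) (∀E hyp₀ (var e))) hyp₁))

record BoundRel : Set where
  field
    rel         : Term → Term → Formula
    rel-substF  : ∀ τ s u → substF τ (rel s u) ≡ rel (subT bv τ s) (subT bv τ u)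
    fv-rel      : ∀ a b {z} → z ∈ FV (rel (var a) (var b)) → z ≡ a ⊎ z ≡ b
    rel-≤-trans : ∀ {Γ s u w} → HA Γ (rel s u) → HA Γ (u ≤ᶠ w) → HA Γ (rel s w)
    ≤-S≤⇒rel    : ∀ {Γ u f x} → HA Γ (u ≤ᶠ f) → HA Γ (S f ≤ᶠ x) → HA Γ (rel u x)

open BoundRel

≤-rel : BoundRel
≤-rel = record
  { rel         = _≤ᶠ_
  ; rel-substF  = ≤ᶠ-subF bv
  ; fv-rel      = λ { a b (here z≡b) → inj₂ z≡b ; a b (there (here z≡a)) → inj₁ z≡a }
  ; rel-≤-trans = ≤ᶠ-trans
  ; ≤-S≤⇒rel    = ≤ᶠ-S≤ᶠ⇒≤ᶠ
  }

<-rel : BoundRel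
<-rel = record
  { rel         = _<ᶠ_
  ; rel-substF  = <ᶠ-subF bv
  ; fv-rel      = λ { a b (here z≡b) → inj₂ z≡b ; a b (there (here z≡a)) → inj₁ z≡a }
  ; rel-≤-trans = <ᶠ-≤ᶠ-trans
  ; ≤-S≤⇒rel    = ≤ᶠ-S≤ᶠ⇒<ᶠ
  }

-- ∀≤[ x ] φ  and  ∀<[ x ] φ  unfold to  ∀⟨ ≤-rel ⟩[ x ] φ  and  ∀⟨ <-rel ⟩[ x ] φ
∀⟨_⟩[_]_ : BoundRel → ℕ → Formula → Formula
∀⟨ R ⟩[ x ] φ = let x' = fresh (x ∷ FV φ) in ∀[ x' ] (rel R (var x') (var x) ⟶ φ [ var x' / x ])

module _ (R : BoundRel) (x : ℕ) (φ : Formula) where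

  private
    x' = fresh (x ∷ FV φ)
    body = rel R (var x') (var x) ⟶ φ [ var x' / x ]

  substF-bounded-body : ∀ τ t → substF (upd τ x' t) body ≡ (rel R t (τ x) ⟶ substF (upd τ x t) φ)
  substF-bounded-body τ t = cong₂ _⟶_
    (trans (rel-substF R _ _ _) (cong₂ (rel R) (upd-same τ x' t) (upd-other τ x' t (fresh≢ (x ∷ FV φ) (here refl)))))
    (substF-rename τ x x' t φ (fresh∉ (x ∷ FV φ) ∘ there))

  inst-bounded : ∀ τ t → inst (subF (lift bv) (wkT ∘ τ) (close x' body)) t ≡ (rel R t (τ x) ⟶ substF (upd τ x t) φ)
  inst-bounded τ t = trans (inst-substF-close τ x' body t) (substF-bounded-body τ t)

  inst-bounded-var : ∀ t → inst (close x' body) t ≡ (rel R t (var x) ⟶ φ [ t / x ])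
  inst-bounded-var t = trans (inst-close x' body t) (substF-bounded-body var t)

  fv-bounded : ∀ {z} → z ∈ FV (∀⟨ R ⟩[ x ] φ) → z ≡ x ⊎ (z ∈ FV φ × z ≢ x)
  fv-bounded p with fv-close x' body p
  ... | q , z≢x' with ∈-++⁻ (FV (rel R (var x') (var x))) q
  ... | inj₁ r with fv-rel R x' x r
  ... | inj₁ z≡x' = ⊥-elim (z≢x' z≡x')
  ... | inj₂ z≡x  = inj₁ z≡x
  fv-bounded p | q , z≢x' | inj₂ r with fv-[/] φ (var x') x r
  ... | inj₁ s          = inj₂ s
  ... | inj₂ (here z≡x') = ⊥-elim (z≢x' z≡x')

  downClosed-bounded-self : DownClosed x (∀⟨ R ⟩[ x ] φ)
  downClosed-bounded-self a = ∀I-fresh [] λ e _ _ →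
    cast (sym (inst-bounded (upd var x (var a)) (var e)))
      (cast (cong (λ t → rel R (var e) t ⟶ substF (upd (upd var x (var a)) x (var e)) φ) (sym (upd-same var x (var a))))
        (⟶R (cast (sym (substF-upd-shadow φ x a e))
          (⟶E (cast (inst-bounded-var (var e)) (∀E hyp₁ (var e))) (rel-≤-trans R hyp₀ hyp₂)))))

  downClosed-bounded : ∀ {y} → x ≢ y → DownClosed y φ → DownClosed y (∀⟨ R ⟩[ x ] φ)
  downClosed-bounded {y} x≢y down a = ∀I-fresh (y ∷ []) λ e _ e∉y →
    cast (sym (inst-bounded (upd var y (var a)) (var e)))
      (cast (cong (λ t → rel R (var e) t ⟶ substF (upd (upd var y (var a)) x (var e)) φ) (sym (upd-other var y (var a) x≢y)))
        (⟶R (cast ([/]-[/]-upd φ x e y a (e∉y ∘ here))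
          (lower (downClosed-rename down x≢y (e∉y ∘ here)) (⟶E (cast (inst-bounded-var (var e)) (∀E hyp₁ (var e))) hyp₀) hyp₂))))

bounded-shift : ∀ R x φ {Γ} f → HA Γ (∀⟨ R ⟩[ x ] φ) → HA Γ (S (var f) ≤ᶠ var x) → HA Γ ((∀⟨ ≤-rel ⟩[ x ] φ) [ var f / x ])
bounded-shift R x φ f d Sf≤x = ∀I-fresh [] λ e _ _ →
  cast (sym (inst-bounded ≤-rel x φ (upd var x (var f)) (var e)))
    (cast (cong (λ t → (var e ≤ᶠ t) ⟶ substF (upd (upd var x (var f)) x (var e)) φ) (sym (upd-same var x (var f))))
      (⟶R (cast (sym (substF-upd-shadow φ x f e))
        (⟶E (cast (inst-bounded-var R x φ (var e)) (∀E (weaken₁ d) (var e))) (≤-S≤⇒rel R hyp₀ (weaken₁ Sf≤x))))))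

boundRel : Sign → BoundRel
boundRel ⁻ = <-rel
boundRel ⁺ = ≤-rel

v⃗ : List ℕ → ℕ → List ℕ
v⃗ V x = deduplicate _≟_ (filter (λ z → ¬? (z ≟ x)) V)

w⃗ : List ℕ → ℕ → List Formula → Formula → List ℕ
w⃗ V x Γ δ = deduplicate _≟_ (filter (λ z → ¬? (z ∈? V)) (filter (λ z → ¬? (z ≟ x)) (FVs Γ δ)))

Îbody : List ℕ → ℕ → List Formula → Formula → Formula
Îbody V x Γ δ = foldr ∀≤[_]_ (foldr ∀[_]_ (⋀ Γ ⟶ δ) (w⃗ V x Γ δ)) (v⃗ V x)

Iof-bounded : ∀ Λ x s Γ δ p → Iof Λ (label x s Γ δ p) ≡ ∀⟨ boundRel s ⟩[ x ] Îbody (Var Λ) x Γ δ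
Iof-bounded Λ x ⁻ Γ δ p = refl
Iof-bounded Λ x ⁺ Γ δ p = refl

v⃗-complete : ∀ {V x z} → z ∈ V → z ≢ x → z ∈ v⃗ V x
v⃗-complete z∈V z≢x = ∈-deduplicate⁺ _≟_ (∈-filter⁺ (λ z → ¬? (z ≟ _)) z∈V z≢x)

v⃗-sound : ∀ V x {z} → z ∈ v⃗ V x → z ∈ V
v⃗-sound V x p = proj₁ (∈-filter⁻ (λ z → ¬? (z ≟ x)) (∈-deduplicate⁻ _≟_ _ p))

w⃗-complete : ∀ {V x Γ δ z} → z ∈ FVs Γ δ → z ≢ x → z ∉ V → z ∈ w⃗ V x Γ δ
w⃗-complete {V} {x} z∈ z≢x z∉V =
  ∈-deduplicate⁺ _≟_ (∈-filter⁺ (λ z → ¬? (z ∈? V)) (∈-filter⁺ (λ z → ¬? (z ≟ x)) z∈ z≢x) z∉V)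

fv-⋀ : ∀ Γ {z} → z ∈ FV (⋀ Γ) → z ∈ concatMap FV Γ
fv-⋀ []            ()
fv-⋀ (φ ∷ [])      p = ∈-++⁺ˡ p
fv-⋀ (φ ∷ ψ ∷ Γ)   p = [ ∈-++⁺ˡ , ∈-++⁺ʳ (FV φ) ∘ fv-⋀ (ψ ∷ Γ) ]′ (∈-++⁻ (FV φ) p)

fv-sequent : ∀ Γ δ {z} → z ∈ FV (⋀ Γ ⟶ δ) → z ∈ FVs Γ δ
fv-sequent Γ δ p = [ ∈-++⁺ˡ ∘ fv-⋀ Γ , ∈-++⁺ʳ (concatMap FV Γ) ]′ (∈-++⁻ (FV (⋀ Γ)) p)

fv-foldr-∀≤ : ∀ xs φ {z} → z ∈ FV (foldr ∀≤[_]_ φ xs) → z ∈ xs ⊎ z ∈ FV φ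
fv-foldr-∀≤ []       φ p = inj₂ p
fv-foldr-∀≤ (x ∷ xs) φ p with fv-bounded ≤-rel x (foldr ∀≤[_]_ φ xs) p
... | inj₁ z≡x = inj₁ (here z≡x)
... | inj₂ (q , _) = map₁ there (fv-foldr-∀≤ xs φ q)

fv-foldr-∀ : ∀ xs φ {z} → z ∈ FV (foldr ∀[_]_ φ xs) → z ∈ FV φ × z ∉ xs
fv-foldr-∀ []       φ p = p , λ ()
fv-foldr-∀ (x ∷ xs) φ p with fv-close x (foldr ∀[_]_ φ xs) p
... | q , z≢x with fv-foldr-∀ xs φ q
... | r , z∉xs = r , λ { (here z≡x) → z≢x z≡x ; (there z∈xs) → z∉xs z∈xs }

fv-Îbody : ∀ V x Γ δ {z} → x ∈ V → z ∈ FV (Îbody V x Γ δ) → z ∈ V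
fv-Îbody V x Γ δ {z} x∈V p with fv-foldr-∀≤ (v⃗ V x) _ p
... | inj₁ q = v⃗-sound V x q
... | inj₂ q with fv-foldr-∀ (w⃗ V x Γ δ) _ q | z ∈? V | z ≟ x
... | _       | yes z∈V | _        = z∈V
... | _       | no _    | yes refl = x∈V
... | r , z∉w | no z∉V  | no z≢x   = ⊥-elim (z∉w (w⃗-complete {V} {x} {Γ} {δ} (fv-sequent Γ δ r) z≢x z∉V))

last-∈ : ∀ {A : Set} (xs : List A) {a} → last xs ≡ just a → a ∈ xs
last-∈ (x ∷ [])     refl = here refl
last-∈ (x ∷ y ∷ xs) eq   = there (last-∈ (y ∷ xs) eq)

fv-I : ∀ Λ → FV (I Λ) ⊆ Var Λ
fv-I Λ p with last Λ in eq
fv-I Λ () | nothing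
fv-I Λ p  | just (label x s Γ δ _) =
  [ (λ { refl → x∈Λ }) , fv-Îbody (Var Λ) x Γ δ x∈Λ ∘ proj₁ ]′
    (fv-bounded (boundRel s) x (Îbody (Var Λ) x Γ δ) (subst (λ φ → _ ∈ FV φ) (Iof-bounded Λ x s Γ δ _) p))
  where
  x∈Λ : x ∈ Var Λ
  x∈Λ = ∈-map⁺ lvar (last-∈ Λ eq)

∈-tail : ∀ {P : Set} {x y} {xs : List ℕ} → y ≢ x → y ∈ x ∷ xs ⊎ P → y ∈ xs ⊎ P
∈-tail y≢x = map₁ λ { (here y≡x) → ⊥-elim (y≢x y≡x) ; (there y∈xs) → y∈xs }

downClosed-foldr-∀≤ : ∀ xs φ {y} → y ∈ xs ⊎ DownClosed y φ → DownClosed y (foldr ∀≤[_]_ φ xs)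
downClosed-foldr-∀≤ []       φ (inj₂ down) = down
downClosed-foldr-∀≤ (x ∷ xs) φ {y} h with y ≟ x
... | yes refl = downClosed-bounded-self ≤-rel y (foldr ∀≤[_]_ φ xs)
... | no y≢x   = downClosed-bounded ≤-rel x (foldr ∀≤[_]_ φ xs) (≢-sym y≢x) (downClosed-foldr-∀≤ xs φ (∈-tail y≢x h))

downClosed-foldr-∀ : ∀ xs φ {y} → y ∈ xs ⊎ DownClosed y φ → DownClosed y (foldr ∀[_]_ φ xs)
downClosed-foldr-∀ []       φ (inj₂ down) = down
downClosed-foldr-∀ (x ∷ xs) φ {y} h with y ≟ x
... | yes refl = downClosed-∉FV (λ p → proj₂ (fv-close y (foldr ∀[_]_ φ xs) p) refl)
... | no y≢x   = downClosed-∀ (downClosed-foldr-∀ xs φ (∈-tail y≢x h)) (≢-sym y≢x)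

downClosed-Îbody : ∀ V x Γ δ {y} → y ≢ x → DownClosed y (Îbody V x Γ δ)
downClosed-Îbody V x Γ δ {y} y≢x with y ∈? V | y ∈? FVs Γ δ
... | yes y∈V | _        = downClosed-foldr-∀≤ (v⃗ V x) _ (inj₁ (v⃗-complete y∈V y≢x))
... | no y∉V  | yes y∈Γδ = downClosed-foldr-∀≤ (v⃗ V x) _ (inj₂ (downClosed-foldr-∀ (w⃗ V x Γ δ) _
                             (inj₁ (w⃗-complete {V} {x} {Γ} {δ} y∈Γδ y≢x y∉V))))
... | no _    | no y∉Γδ  = downClosed-foldr-∀≤ (v⃗ V x) _ (inj₂ (downClosed-foldr-∀ (w⃗ V x Γ δ) _
                             (inj₂ (downClosed-∉FV (y∉Γδ ∘ fv-sequent Γ δ)))))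

downClosed-I : ∀ Λ y → DownClosed y (I Λ)
downClosed-I Λ y with last Λ
... | nothing                  = downClosed-⊤
... | just (label x s Γ δ p) with y ≟ x
...   | yes refl = subst (DownClosed y) (sym (Iof-bounded Λ x s Γ δ p)) (downClosed-bounded-self (boundRel s) x _)
...   | no y≢x   = subst (DownClosed y) (sym (Iof-bounded Λ x s Γ δ p))
                     (downClosed-bounded (boundRel s) x _ (≢-sym y≢x) (downClosed-Îbody (Var Λ) x Γ δ y≢x))

module CaseFm (x : ℕ) (A B : Formula) where

  private
    avoid₁ = x ∷ FV A ++ FV B
    x' = fresh avoid₁
    avoid₂ = x' ∷ x ∷ FV A ++ FV B
    x'' = fresh avoid₂

    x'∉A : x' ∉ FV A
    x'∉A = fresh∉ avoid₁ ∘ there ∘ ∈-++⁺ˡ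
    x'∉B : x' ∉ FV B
    x'∉B = fresh∉ avoid₁ ∘ there ∘ ∈-++⁺ʳ (FV A)
    x''∉B : x'' ∉ FV B
    x''∉B = fresh∉ avoid₂ ∘ there ∘ there ∘ ∈-++⁺ʳ (FV A)

    succ-branch : Formula
    succ-branch = (var x' ≐ S (var x'')) ∧ᶠ B [ var x'' / x ]

    body : Formula
    body = (var x' ≤ᶠ var x) ⟶ (((var x' ≐ 𝟎) ∧ᶠ A [ var x' / x ]) ∨ᶠ ∃[ x'' ] succ-branch)

  -- the existential disjunct of the body, after substituting τ and instantiating x' by t
  SuccCase : (ℕ → Term) → Term → Fm 1
  SuccCase τ t = subF (lift bv) (wkT ∘ upd τ x' t) (close x'' succ-branch)

  inst-SuccCase : ∀ τ t s → inst (SuccCase τ t) s ≡ ((t ≐ S s) ∧ᶠ substF (upd τ x s) B)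
  inst-SuccCase τ t s = trans (inst-substF-close (upd τ x' t) x'' succ-branch s) (cong₂ _∧ᶠ_
    (cong₂ _≐_ (trans (upd-other (upd τ x' t) x'' s (fresh≢ avoid₂ (here refl))) (upd-same τ x' t))
               (cong S (upd-same (upd τ x' t) x'' s)))
    (trans (substF-rename (upd τ x' t) x x'' s B x''∉B) (substF-cong B agree)))
    where
    agree : Agree (FV B) (upd (upd τ x' t) x s) (upd τ x s)
    agree w w∈B with w ≟ x
    ... | yes refl rewrite ≡ᵇ-refl w = refl
    ... | no w≢x rewrite ≢⇒≡ᵇ-false w≢x | ≢⇒≡ᵇ-false {w} {x'} (λ { refl → x'∉B w∈B }) = refl

  substF-body : ∀ τ t → substF (upd τ x' t) body
    ≡ ((t ≤ᶠ τ x) ⟶ (((t ≐ 𝟎) ∧ᶠ substF (upd τ x t) A) ∨ᶠ ex (SuccCase τ t)))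
  substF-body τ t = cong₂ _⟶_
    (trans (≤ᶠ-subF bv (upd τ x' t) (var x') (var x))
           (cong₂ _≤ᶠ_ (upd-same τ x' t) (upd-other τ x' t (fresh≢ avoid₁ (here refl)))))
    (cong (_∨ᶠ ex (SuccCase τ t)) (cong₂ _∧ᶠ_ (cong (_≐ 𝟎) (upd-same τ x' t)) (substF-rename τ x x' t A x'∉A)))

  Split : Term → Formula
  Split t = ((t ≐ 𝟎) ∧ᶠ A [ t / x ]) ∨ᶠ ex (SuccCase var t)

  inst-caseFm : ∀ t → inst (close x' body) t ≡ ((t ≤ᶠ var x) ⟶ Split t)
  inst-caseFm t = trans (inst-close x' body t) (substF-body var t)

  inst-substF-caseFm : ∀ τ t → inst (subF (lift bv) (wkT ∘ τ) (close x' body)) t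
    ≡ ((t ≤ᶠ τ x) ⟶ (((t ≐ 𝟎) ∧ᶠ substF (upd τ x t) A) ∨ᶠ ex (SuccCase τ t)))
  inst-substF-caseFm τ t = trans (inst-substF-close τ x' body t) (substF-body τ t)

  fv-caseFm : ∀ {z} → z ∈ FV (caseFm x A B) → z ≡ x ⊎ (z ∈ FV A ⊎ z ∈ FV B)
  fv-caseFm p with fv-close x' body p
  ... | q , z≢x' with ∈-++⁻ (FV (var {0} x' ≤ᶠ var x)) q
  ... | inj₁ (here z≡x)          = inj₁ z≡x
  ... | inj₁ (there (here z≡x')) = ⊥-elim (z≢x' z≡x')
  ... | inj₂ r with ∈-++⁻ (FV ((var x' ≐ 𝟎) ∧ᶠ A [ var x' / x ])) r
  ... | inj₁ s with ∈-++⁻ (FV (var {0} x' ≐ 𝟎)) s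
  ... | inj₁ (here z≡x') = ⊥-elim (z≢x' z≡x')
  ... | inj₂ s' with fv-[/] A (var x') x s'
  ... | inj₁ (z∈A , _)  = inj₂ (inj₁ z∈A)
  ... | inj₂ (here z≡x') = ⊥-elim (z≢x' z≡x')
  fv-caseFm p | q , z≢x' | inj₂ r | inj₂ s with fv-close x'' succ-branch s
  ... | u , z≢x'' with ∈-++⁻ (FV (var {0} x' ≐ S (var x''))) u
  ... | inj₁ (here z≡x')          = ⊥-elim (z≢x' z≡x')
  ... | inj₁ (there (here z≡x'')) = ⊥-elim (z≢x'' z≡x'')
  ... | inj₂ u' with fv-[/] B (var x'') x u'
  ... | inj₁ (z∈B , _)   = inj₂ (inj₂ z∈B)
  ... | inj₂ (here z≡x'') = ⊥-elim (z≢x'' z≡x'')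

  caseFm-intro : ∀ {Γ} → (∀ e → HA ((var e ≤ᶠ var x) ∷ Γ) (Split (var e))) → HA Γ (caseFm x A B)
  caseFm-intro k = ∀I-fresh [] λ e _ _ → cast (sym (inst-caseFm (var e))) (⟶R (k e))

  caseFm-elim : ∀ {Γ} e → HA Γ (caseFm x A B) → HA Γ (var e ≤ᶠ var x) → HA Γ (Split (var e))
  caseFm-elim e d e≤x = ⟶E (cast (inst-caseFm (var e)) (∀E d (var e))) e≤x

  split-zero : ∀ {Γ t} → HA Γ (t ≐ 𝟎) → HA Γ (A [ t / x ]) → HA Γ (Split t)
  split-zero t≐0 a = ∨R₁ (∧R t≐0 a)

  split-suc : ∀ {Γ t} f → HA Γ (t ≐ S (var f)) → HA Γ (B [ var f / x ]) → HA Γ (Split t)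
  split-suc {t = t} f t≐Sf b = ∨R₂ (∃R (var f) (cast (sym (inst-SuccCase var t (var f))) (∧R t≐Sf b)))

  split-elim : ∀ {Γ C} e → HA Γ (Split (var e)) →
    HA ((var e ≐ 𝟎) ∷ A [ var e / x ] ∷ Γ) C →
    (∀ f → HA ((var e ≐ S (var f)) ∷ B [ var f / x ] ∷ Γ) C) → HA Γ C
  split-elim {Γ} e d on-zero on-suc = ∨E d (∧L on-zero) (∃E-fresh [] hyp₀ λ f _ _ →
    castˡ (cong (_∷ ex (SuccCase var (var e)) ∷ Γ) (sym (inst-SuccCase var (var e) (var f))))
      (∧L (wk (λ { (here p) → here p ; (there (here p)) → there (here p) ; (there (there p)) → there (there (there p)) })
              (on-suc f))))

  -- when x occurs in neither A nor B, splitting on e is just the zero-or-successor dichotomy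
  split-∉FV : ∀ {Γ} e → x ∉ FV A → x ∉ FV B → HA Γ A → HA Γ B → HA Γ (Split (var e))
  split-∉FV e x∉A x∉B a b = ∨E (zero-or-suc (var e))
    (split-zero hyp₀ (cast (sym ([/]-∉FV A (var e) x∉A)) (weaken₁ a)))
    (∃E-fresh [] hyp₀ λ f _ _ → split-suc f hyp₀ (cast (sym ([/]-∉FV B (var f) x∉B)) (weaken₁ (weaken₁ b))))

  downClosed-caseFm : (∀ y → DownClosed y A) → (∀ y → DownClosed y B) → ∀ y → DownClosed y (caseFm x A B)
  downClosed-caseFm down-A down-B y a = ∀I-fresh (y ∷ []) λ e _ e∉y →
    cast (sym (inst-substF-caseFm (upd var y (var a)) (var e)))
      (⟶R (∨E (⟶E (cast (inst-caseFm (var e)) (∀E hyp₁ (var e))) (≤-lowered e hyp₀ hyp₂))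
        (∨R₁ (∧R (∧E₁ hyp₀) (lower-instance A down-A e (e∉y ∘ here) (∧E₂ hyp₀) hyp₃)))
        (∃E-fresh (y ∷ []) hyp₀ λ f _ f∉y → ∨R₂ (∃R (var f) (cast (sym (inst-SuccCase (upd var y (var a)) (var e) (var f)))
          (∧R (∧E₁ (cast (inst-SuccCase var (var e) (var f)) hyp₀))
              (lower-instance B down-B f (f∉y ∘ here) (∧E₂ (cast (inst-SuccCase var (var e) (var f)) hyp₀)) hyp₄)))))))
    where
    ≤-lowered : ∀ {Γ} e → HA Γ (var e ≤ᶠ upd var y (var a) x) → HA Γ (var a ≤ᶠ var y) → HA Γ (var e ≤ᶠ var x)
    ≤-lowered e e≤ a≤y with x ≟ y
    ... | yes refl rewrite ≡ᵇ-refl x = ≤ᶠ-trans e≤ a≤y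
    ... | no x≢y rewrite ≢⇒≡ᵇ-false x≢y = e≤
    lower-instance : ∀ C → (∀ y → DownClosed y C) → ∀ {Γ} e → e ≢ y → HA Γ (C [ var e / x ]) → HA Γ (var a ≤ᶠ var y)
      → HA Γ (substF (upd (upd var y (var a)) x (var e)) C)
    lower-instance C down e e≢y d a≤y with x ≟ y
    ... | yes refl = cast (sym (substF-upd-shadow C x a e)) d
    ... | no x≢y   = cast ([/]-[/]-upd C x e y a e≢y) (lower (downClosed-rename (down y) x≢y e≢y) d a≤y)

take-++ : ∀ {A : Set} n (xs ys : List A) → n ≤ length xs → take n (xs ++ ys) ≡ take n xs
take-++ zero    xs       ys n≤ = refl
take-++ (suc n) (x ∷ xs) ys (s≤s n≤) = cong (x ∷_) (take-++ n xs ys n≤)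

≤-length-++ : ∀ {A : Set} {n} (xs ys : List A) → n ≤ length xs → n ≤ length (xs ++ ys)
≤-length-++ xs ys n≤ = subst (_ ≤_) (sym (length-++ xs)) (≤-trans n≤ (m≤m+n (length xs) (length ys)))

take-⊆ : ∀ {A : Set} {m n} (xs : List A) → m ≤ n → take m xs ⊆ take n xs
take-⊆ {m = suc m} {suc n} (x ∷ xs) (s≤s m≤n) (here eq) = here eq
take-⊆ {m = suc m} {suc n} (x ∷ xs) (s≤s m≤n) (there p) = there (take-⊆ xs m≤n p)

Var-↾-⊆ : ∀ {m n} Λ → m ≤ n → Var (Λ ↾ m) ⊆ Var (Λ ↾ n)
Var-↾-⊆ Λ m≤n p with ∈-map⁻ lvar p
... | ℓ , ℓ∈ , refl = ∈-map⁺ lvar (take-⊆ Λ m≤n ℓ∈)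

lvar-plus : ∀ x ℓ → lvar (plus x ℓ) ≡ lvar ℓ
lvar-plus x (label y ⁻ Γ δ p) with y ≡ᵇ x
... | true  = refl
... | false = refl
lvar-plus x (label y ⁺ Γ δ p) = refl

length-⁺ : ∀ x Λ → length (Λ ⁺[ x ]) ≡ length Λ
length-⁺ x = length-map (plus x)

Var-⁺ : ∀ x Λ → Var (Λ ⁺[ x ]) ≡ Var Λ
Var-⁺ x Λ = trans (sym (map-∘ Λ)) (map-cong (lvar-plus x) Λ)

Var-⁺-↾ : ∀ x n Λ → Var ((Λ ⁺[ x ]) ↾ n) ≡ Var (Λ ↾ n)
Var-⁺-↾ x n Λ = trans (cong Var (take-map n Λ)) (Var-⁺ x (Λ ↾ n))

plus-other : ∀ x ℓ → lvar ℓ ≢ x → plus x ℓ ≡ ℓ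
plus-other x (label y ⁻ Γ δ p) y≢x rewrite ≢⇒≡ᵇ-false y≢x = refl
plus-other x (label y ⁺ Γ δ p) y≢x = refl

plus-self : ∀ x s Γ δ p → plus x (label x s Γ δ p) ≡ label x ⁺ Γ δ p
plus-self x ⁻ Γ δ p rewrite ≡ᵇ-refl x = refl
plus-self x ⁺ Γ δ p = refl

⁺-∉Var : ∀ x Λ → x ∉ Var Λ → Λ ⁺[ x ] ≡ Λ
⁺-∉Var x []      x∉ = refl
⁺-∉Var x (ℓ ∷ Λ) x∉ = cong₂ _∷_ (plus-other x ℓ (x∉ ∘ here ∘ sym)) (⁺-∉Var x Λ (x∉ ∘ there))

I-last : ∀ {Λ ℓ} → last Λ ≡ just ℓ → I Λ ≡ Iof Λ ℓ
I-last {Λ} = cong (maybe (Iof Λ) ⊤ᶠ)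

Iof-⁺ : ∀ x Λ ℓ → Iof (Λ ⁺[ x ]) ℓ ≡ Iof Λ ℓ
Iof-⁺ x Λ (label z s Γ δ p) = begin
  Iof (Λ ⁺[ x ]) (label z s Γ δ p)          ≡⟨ Iof-bounded (Λ ⁺[ x ]) z s Γ δ p ⟩
  ∀⟨ boundRel s ⟩[ z ] Îbody (Var (Λ ⁺[ x ])) z Γ δ ≡⟨ cong (λ V → ∀⟨ boundRel s ⟩[ z ] Îbody V z Γ δ) (Var-⁺ x Λ) ⟩
  ∀⟨ boundRel s ⟩[ z ] Îbody (Var Λ) z Γ δ   ≡⟨ sym (Iof-bounded Λ z s Γ δ p) ⟩
  Iof Λ (label z s Γ δ p)                    ∎
  where open ≡-Reasoning

I-⁺ : ∀ {Λ ℓ} x → last Λ ≡ just ℓ → I (Λ ⁺[ x ]) ≡ Iof Λ (plus x ℓ)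
I-⁺ {Λ} {ℓ} x eq = trans (I-last (trans (last-map (plus x) Λ) (cong (Maybe.map (plus x)) eq))) (Iof-⁺ x Λ (plus x ℓ))

I-⁺-shift : ∀ {Γ} Λ x f → x ∈ Var Λ → HA Γ (I Λ) → HA Γ (S (var f) ≤ᶠ var x) → HA Γ (I (Λ ⁺[ x ]) [ var f / x ])
I-⁺-shift Λ x f x∈Λ d Sf≤x with last Λ in eq
I-⁺-shift (ℓ ∷ Λ) x f x∈Λ d Sf≤x | nothing = ⊥-elim (last-nonempty Λ eq)
  where
  last-nonempty : ∀ {A : Set} {a} (xs : List A) → last (a ∷ xs) ≢ nothing
  last-nonempty []       ()
  last-nonempty (y ∷ xs) = last-nonempty xs
I-⁺-shift Λ x f x∈Λ d Sf≤x | just (label z s Γ δ p) with z ≟ x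
... | no z≢x = cast (cong (_[ var f / x ]) (trans (I-last eq) (sym (trans (I-⁺ x eq) (cong (Iof Λ) (plus-other x _ z≢x))))))
                 (lower (downClosed-I Λ x) (cast (sym (I-last eq)) d) (S≤ᶠ⇒≤ᶠ Sf≤x))
... | yes refl = cast (cong (_[ var f / x ]) (sym (trans (I-⁺ x eq) (cong (Iof Λ) (plus-self x s Γ δ p)))))
                   (bounded-shift (boundRel s) x (Îbody (Var Λ) x Γ δ) f
                     (cast (Iof-bounded Λ x s Γ δ p) d) Sf≤x)

if-yes : ∀ {P A : Set} (d : Dec P) {a b : A} → P → (if does d then a else b) ≡ a
if-yes (yes _) _ = refl
if-yes (no ¬p) p = ⊥-elim (¬p p)

if-no : ∀ {P A : Set} (d : Dec P) {a b : A} → ¬ P → (if does d then a else b) ≡ b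
if-no (yes p) ¬p = ⊥-elim (¬p p)
if-no (no _)  _  = refl

H-pop : ∀ {Λ₀ Γ δ} Λ' (π : SHA Λ₀ Γ δ) n → H n (pop Λ' π) ≡ H (length Λ₀ ⊓ n) π
H-pop {Λ₀} Λ' π zero rewrite ⊓-zeroʳ (length Λ₀) = refl
H-pop Λ' π (suc k) = refl

H-comp : ∀ {Λ Γ δ x} (p : x ∈ FVs Γ δ) (wf : WF Λ Γ δ) (π : SHA (Λ ∷ʳ label x ⁻ Γ δ p) Γ δ) n → H n (comp p wf π) ≡ H n π
H-comp p wf π zero    = refl
H-comp p wf π (suc k) = refl

H-bud : ∀ {Λ Γ δ x} (p : x ∈ FVs Γ δ) (wf : WF (Λ ∷ʳ label x ⁺ Γ δ p) Γ δ) n → let Λ⁺ = Λ ∷ʳ label x ⁺ Γ δ p in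
  H n (bud {Λ} {Γ} {δ} {x} p wf) ≡ ⊤ᶠ ⊎ (n ≡ length Λ⁺ × H n (bud {Λ} {Γ} {δ} {x} p wf) ≡ I Λ⁺)
H-bud p wf zero = inj₁ refl
H-bud {Λ} {Γ} {δ} {x} p wf (suc k) with length (Λ ∷ʳ label x ⁺ Γ δ p) ≟ suc k
... | yes eq rewrite eq | ≡ᵇ-refl k = inj₂ (refl , refl)
... | no ≢    rewrite ≢⇒≡ᵇ-false ≢ = inj₁ refl

module _ {Λ Γ δ} x (wf : WF Λ Γ δ) (π₀ : SHA Λ (Γ [ 𝟎 / x ]*) (δ [ 𝟎 / x ]))
         (πₛ : SHA (Λ ⁺[ x ]) (Γ [ S (var x) / x ]*) (δ [ S (var x) / x ])) where

  H-case-∈ : ∀ k → x ∈ Var (Λ ↾ suc k) → H (suc k) (case x wf π₀ πₛ) ≡ caseFm x (H (suc k) π₀) (H (suc k) πₛ)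
  H-case-∈ k = if-yes (x ∈? Var (Λ ↾ suc k))

  H-case-∉ : ∀ k → x ∉ Var (Λ ↾ suc k) → H (suc k) (case x wf π₀ πₛ) ≡ H (suc k) π₀ ∧ᶠ H (suc k) πₛ
  H-case-∉ k = if-no (x ∈? Var (Λ ↾ suc k))

-- Structural induction on SHA-derivations, grouping the rules by how H_n(π) is computed from the premises.
record SHA-Induction (P : ∀ {Λ Γ δ} → SHA Λ Γ δ → Set) : Set₁ where
  field
    on-trivial : ∀ {Λ Γ δ} (π : SHA Λ Γ δ) → (∀ n → H n π ≡ ⊤ᶠ) → P π
    on-unary   : ∀ {Λ Γ δ Γ' δ'} (π : SHA Λ Γ δ) (π' : SHA Λ Γ' δ') → (∀ n → H n π ≡ H n π') → P π' → P π
    on-binary  : ∀ {Λ Γ δ Γ₁ δ₁ Γ₂ δ₂} (π : SHA Λ Γ δ) (π₁ : SHA Λ Γ₁ δ₁) (π₂ : SHA Λ Γ₂ δ₂) →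
                 (∀ k → H (suc k) π ≡ H (suc k) π₁ ∧ᶠ H (suc k) π₂) → P π₁ → P π₂ → P π
    on-comp    : ∀ {Λ Γ δ x} (p : x ∈ FVs Γ δ) (wf : WF Λ Γ δ) (π : SHA (Λ ∷ʳ label x ⁻ Γ δ p) Γ δ) → P π → P (comp {Λ} p wf π)
    on-bud     : ∀ {Λ Γ δ x} (p : x ∈ FVs Γ δ) (wf : WF (Λ ∷ʳ label x ⁺ Γ δ p) Γ δ) → P (bud {Λ} {Γ} {δ} {x} p wf)
    on-pop     : ∀ {Λ Γ δ} Λ' (π : SHA Λ Γ δ) → P π → P (pop Λ' π)
    on-case    : ∀ {Λ Γ δ} x (wf : WF Λ Γ δ) (π₀ : SHA Λ (Γ [ 𝟎 / x ]*) (δ [ 𝟎 / x ]))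
                 (πₛ : SHA (Λ ⁺[ x ]) (Γ [ S (var x) / x ]*) (δ [ S (var x) / x ])) → P π₀ → P πₛ → P (case {Λ} {Γ} {δ} x wf π₀ πₛ)

module _ {P : ∀ {Λ Γ δ} → SHA Λ Γ δ → Set} (ind : SHA-Induction P) where

  open SHA-Induction ind

  private
    H-⊤ : ∀ {Λ Γ δ} {π : SHA Λ Γ δ} → (∀ k → H (suc k) π ≡ ⊤ᶠ) → ∀ n → H n π ≡ ⊤ᶠ
    H-⊤ eq zero    = refl
    H-⊤ eq (suc k) = eq k

    H-≡ : ∀ {Λ Γ δ Γ' δ'} {π : SHA Λ Γ δ} {π' : SHA Λ Γ' δ'} → (∀ k → H (suc k) π ≡ H (suc k) π') → ∀ n → H n π ≡ H n π'
    H-≡ eq zero    = refl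
    H-≡ eq (suc k) = eq k

  sha-induction : ∀ {Λ Γ δ} (π : SHA Λ Γ δ) → P π
  sha-induction π@(ax _)          = on-trivial π (H-⊤ λ _ → refl)
  sha-induction π@(ax0S _)        = on-trivial π (H-⊤ λ _ → refl)
  sha-induction π@(axSS _ _)      = on-trivial π (H-⊤ λ _ → refl)
  sha-induction π@(ax+0 _)        = on-trivial π (H-⊤ λ _ → refl)
  sha-induction π@(ax+S _ _)      = on-trivial π (H-⊤ λ _ → refl)
  sha-induction π@(ax·0 _)        = on-trivial π (H-⊤ λ _ → refl)
  sha-induction π@(ax·S _ _)      = on-trivial π (H-⊤ λ _ → refl)
  sha-induction π@(⊥L _)          = on-trivial π (H-⊤ λ _ → refl)
  sha-induction π@(=R _ _)        = on-trivial π (H-⊤ λ _ → refl)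
  sha-induction π@(wk _ _ π')     = on-unary π π' (H-≡ λ _ → refl) (sha-induction π')
  sha-induction π@(∧L _ π')       = on-unary π π' (H-≡ λ _ → refl) (sha-induction π')
  sha-induction π@(∨R₁ _ π')      = on-unary π π' (H-≡ λ _ → refl) (sha-induction π')
  sha-induction π@(∨R₂ _ π')      = on-unary π π' (H-≡ λ _ → refl) (sha-induction π')
  sha-induction π@(⟶R _ π')       = on-unary π π' (H-≡ λ _ → refl) (sha-induction π')
  sha-induction π@(∀R _ _ _ π')   = on-unary π π' (H-≡ λ _ → refl) (sha-induction π')
  sha-induction π@(∀L _ _ π')     = on-unary π π' (H-≡ λ _ → refl) (sha-induction π')
  sha-induction π@(∃R _ _ π')     = on-unary π π' (H-≡ λ _ → refl) (sha-induction π')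
  sha-induction π@(∃L _ _ _ π')   = on-unary π π' (H-≡ λ _ → refl) (sha-induction π')
  sha-induction π@(=L _ π')       = on-unary π π' (H-≡ λ _ → refl) (sha-induction π')
  sha-induction π@(cut _ π₁ π₂)   = on-binary π π₁ π₂ (λ _ → refl) (sha-induction π₁) (sha-induction π₂)
  sha-induction π@(∧R _ π₁ π₂)    = on-binary π π₁ π₂ (λ _ → refl) (sha-induction π₁) (sha-induction π₂)
  sha-induction π@(∨L _ π₁ π₂)    = on-binary π π₁ π₂ (λ _ → refl) (sha-induction π₁) (sha-induction π₂)
  sha-induction π@(⟶L _ π₁ π₂)    = on-binary π π₁ π₂ (λ _ → refl) (sha-induction π₁) (sha-induction π₂)
  sha-induction (comp p wf π)     = on-comp p wf π (sha-induction π)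
  sha-induction (bud p wf)        = on-bud p wf
  sha-induction (pop Λ' π)        = on-pop Λ' π (sha-induction π)
  sha-induction (case x wf π₀ πₛ) = on-case x wf π₀ πₛ (sha-induction π₀) (sha-induction πₛ)

-- (i) H_n(π) only mentions the variables of Λ ↾ n

fv-∧ᶠ : ∀ (A B : Formula) {V : List ℕ} → FV A ⊆ V → FV B ⊆ V → FV (A ∧ᶠ B) ⊆ V
fv-∧ᶠ A B fv-A fv-B p = [ fv-A , fv-B ]′ (∈-++⁻ (FV A) p)

fv-≡ : ∀ {φ ψ : Formula} {V} → φ ≡ ψ → FV ψ ⊆ V → FV φ ⊆ V
fv-≡ refl fv-ψ = fv-ψ

FV-Bounded : ∀ {Λ Γ δ} → SHA Λ Γ δ → Set
FV-Bounded {Λ} π = ∀ n → n ≤ length Λ → FV (H n π) ⊆ Var (Λ ↾ n)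

fv-H-trivial : ∀ {Λ Γ δ} (π : SHA Λ Γ δ) → (∀ n → H n π ≡ ⊤ᶠ) → FV-Bounded π
fv-H-trivial π eq n _ = fv-≡ (eq n) (λ ())

fv-H-unary : ∀ {Λ Γ δ Γ' δ'} (π : SHA Λ Γ δ) (π' : SHA Λ Γ' δ') → (∀ n → H n π ≡ H n π') → FV-Bounded π' → FV-Bounded π
fv-H-unary π π' eq ih n n≤ = fv-≡ (eq n) (ih n n≤)

fv-H-comp : ∀ {Λ Γ δ x} (p : x ∈ FVs Γ δ) (wf : WF Λ Γ δ) (π : SHA (Λ ∷ʳ label x ⁻ Γ δ p) Γ δ) → FV-Bounded π → FV-Bounded (comp p wf π)
fv-H-comp {Λ} p wf π ih n n≤ = fv-≡ (H-comp p wf π n) (subst (λ L → FV (H n π) ⊆ Var L) (take-++ n Λ _ n≤) (ih n (≤-length-++ Λ _ n≤)))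

fv-H-binary : ∀ {Λ Γ δ Γ₁ δ₁ Γ₂ δ₂} (π : SHA Λ Γ δ) (π₁ : SHA Λ Γ₁ δ₁) (π₂ : SHA Λ Γ₂ δ₂) →
  (∀ k → H (suc k) π ≡ H (suc k) π₁ ∧ᶠ H (suc k) π₂) → FV-Bounded π₁ → FV-Bounded π₂ → FV-Bounded π
fv-H-binary π π₁ π₂ eq ih₁ ih₂ zero    _  = λ ()
fv-H-binary π π₁ π₂ eq ih₁ ih₂ (suc k) n≤ = fv-≡ (eq k) (fv-∧ᶠ (H (suc k) π₁) (H (suc k) π₂) (ih₁ (suc k) n≤) (ih₂ (suc k) n≤))

fv-H-bud : ∀ {Λ Γ δ x} (p : x ∈ FVs Γ δ) (wf : WF (Λ ∷ʳ label x ⁺ Γ δ p) Γ δ) → FV-Bounded (bud p wf)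
fv-H-bud {Λ} {Γ} {δ} {x} p wf n n≤ with H-bud p wf n
... | inj₁ eq          = fv-≡ eq (λ ())
... | inj₂ (refl , eq) = subst₂ (λ φ L → FV φ ⊆ Var L) (sym eq) (sym (take-all n Λ⁺ ≤-refl)) (fv-I Λ⁺)
  where Λ⁺ = Λ ∷ʳ label x ⁺ Γ δ p

fv-H-pop : ∀ {Λ₀ Γ δ} Λ' (π : SHA Λ₀ Γ δ) → FV-Bounded π → FV-Bounded (pop Λ' π)
fv-H-pop {Λ₀} Λ' π ih n _ =
  fv-≡ (H-pop Λ' π n)
    (Var-↾-⊆ (Λ₀ ++ Λ') (m⊓n≤n _ n) ∘ subst (λ L → _ ∈ Var L) (sym (take-++ m Λ₀ Λ' m≤)) ∘ ih m m≤)
  where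
  m = length Λ₀ ⊓ n
  m≤ = m⊓n≤m (length Λ₀) n

fv-H-case : ∀ {Λ Γ δ} x (wf : WF Λ Γ δ) (π₀ : SHA Λ (Γ [ 𝟎 / x ]*) (δ [ 𝟎 / x ]))
  (πₛ : SHA (Λ ⁺[ x ]) (Γ [ S (var x) / x ]*) (δ [ S (var x) / x ])) →
  FV-Bounded π₀ → FV-Bounded πₛ → FV-Bounded (case x wf π₀ πₛ)
fv-H-case x wf π₀ πₛ ih₀ ihₛ zero    _  = λ ()
fv-H-case {Λ} x wf π₀ πₛ ih₀ ihₛ (suc k) n≤ = by-cases (x ∈? Var (Λ ↾ suc k))
  where
  fv-Hₛ : FV (H (suc k) πₛ) ⊆ Var (Λ ↾ suc k)
  fv-Hₛ = subst (_ ∈_) (Var-⁺-↾ x (suc k) Λ) ∘ ihₛ (suc k) (subst (suc k ≤_) (sym (length-⁺ x Λ)) n≤)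
  by-cases : Dec (x ∈ Var (Λ ↾ suc k)) → FV (H (suc k) (case x wf π₀ πₛ)) ⊆ Var (Λ ↾ suc k)
  by-cases (yes x∈) = fv-≡ (H-case-∈ x wf π₀ πₛ k x∈)
                        ([ (λ { refl → x∈ }) , [ ih₀ (suc k) n≤ , fv-Hₛ ]′ ]′ ∘ CaseFm.fv-caseFm x (H (suc k) π₀) (H (suc k) πₛ))
  by-cases (no x∉)  = fv-≡ (H-case-∉ x wf π₀ πₛ k x∉) (fv-∧ᶠ (H (suc k) π₀) (H (suc k) πₛ) (ih₀ (suc k) n≤) fv-Hₛ)

fv-H : ∀ {Λ Γ δ} (π : SHA Λ Γ δ) → FV-Bounded π
fv-H = sha-induction record
  { on-trivial = fv-H-trivial
  ; on-unary   = fv-H-unary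
  ; on-binary  = fv-H-binary
  ; on-comp    = fv-H-comp
  ; on-bud     = fv-H-bud
  ; on-pop     = fv-H-pop
  ; on-case    = fv-H-case
  }

-- (ii) H_n(π) is downward closed in every variable

downClosed-≡ : ∀ {y} {φ ψ : Formula} → φ ≡ ψ → DownClosed y ψ → DownClosed y φ
downClosed-≡ refl down = down

DownClosed-H : ∀ {Λ Γ δ} → SHA Λ Γ δ → Set
DownClosed-H π = ∀ n y → DownClosed y (H n π)

downClosed-H-binary : ∀ {Λ Γ δ Γ₁ δ₁ Γ₂ δ₂} (π : SHA Λ Γ δ) (π₁ : SHA Λ Γ₁ δ₁) (π₂ : SHA Λ Γ₂ δ₂) →
  (∀ k → H (suc k) π ≡ H (suc k) π₁ ∧ᶠ H (suc k) π₂) → DownClosed-H π₁ → DownClosed-H π₂ → DownClosed-H π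
downClosed-H-binary π π₁ π₂ eq ih₁ ih₂ zero    y = downClosed-⊤
downClosed-H-binary π π₁ π₂ eq ih₁ ih₂ (suc k) y = downClosed-≡ (eq k) (downClosed-∧ (ih₁ (suc k) y) (ih₂ (suc k) y))

downClosed-H-bud : ∀ {Λ Γ δ x} (p : x ∈ FVs Γ δ) (wf : WF (Λ ∷ʳ label x ⁺ Γ δ p) Γ δ) → DownClosed-H (bud p wf)
downClosed-H-bud {Λ} {Γ} {δ} {x} p wf n y with H-bud p wf n
... | inj₁ eq       = downClosed-≡ eq downClosed-⊤
... | inj₂ (_ , eq) = downClosed-≡ eq (downClosed-I (Λ ∷ʳ label x ⁺ Γ δ p) y)

downClosed-H-case : ∀ {Λ Γ δ} x (wf : WF Λ Γ δ) (π₀ : SHA Λ (Γ [ 𝟎 / x ]*) (δ [ 𝟎 / x ]))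
  (πₛ : SHA (Λ ⁺[ x ]) (Γ [ S (var x) / x ]*) (δ [ S (var x) / x ])) →
  DownClosed-H π₀ → DownClosed-H πₛ → DownClosed-H (case x wf π₀ πₛ)
downClosed-H-case x wf π₀ πₛ ih₀ ihₛ zero y = downClosed-⊤
downClosed-H-case {Λ} x wf π₀ πₛ ih₀ ihₛ (suc k) y = by-cases (x ∈? Var (Λ ↾ suc k))
  where
  by-cases : Dec (x ∈ Var (Λ ↾ suc k)) → DownClosed y (H (suc k) (case x wf π₀ πₛ))
  by-cases (yes x∈) = downClosed-≡ (H-case-∈ x wf π₀ πₛ k x∈) (CaseFm.downClosed-caseFm x _ _ (ih₀ (suc k)) (ihₛ (suc k)) y)
  by-cases (no x∉)  = downClosed-≡ (H-case-∉ x wf π₀ πₛ k x∉) (downClosed-∧ (ih₀ (suc k) y) (ihₛ (suc k) y))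

downClosed-H : ∀ {Λ Γ δ} (π : SHA Λ Γ δ) → DownClosed-H π
downClosed-H = sha-induction record
  { on-trivial = λ π eq n y → downClosed-≡ (eq n) downClosed-⊤
  ; on-unary   = λ π π' eq ih n y → downClosed-≡ (eq n) (ih n y)
  ; on-binary  = downClosed-H-binary
  ; on-comp    = λ p wf π ih n y → downClosed-≡ (H-comp p wf π n) (ih n y)
  ; on-bud     = downClosed-H-bud
  ; on-pop     = λ {Λ₀} Λ' π ih n y → downClosed-≡ (H-pop Λ' π n) (ih (length Λ₀ ⊓ n) y)
  ; on-case    = downClosed-H-case
  }

-- (iii) I_{Λ↾(n+1)} turns H_n(π) into H_{n+1}(π)

Step : ∀ {Λ Γ δ} → SHA Λ Γ δ → Set
Step {Λ} π = ∀ n → n < length Λ → HA (H n π ∷ I (Λ ↾ suc n) ∷ []) (H (suc n) π)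

step-≡ : ∀ {A A' B B' J : Formula} → A ≡ A' → B ≡ B' → HA (A' ∷ J ∷ []) B' → HA (A ∷ J ∷ []) B
step-≡ refl refl d = d

step-trivial : ∀ {Λ Γ δ} (π : SHA Λ Γ δ) → (∀ n → H n π ≡ ⊤ᶠ) → Step π
step-trivial π eq n _ = step-≡ (eq n) (eq (suc n)) ⊤-intro

step-unary : ∀ {Λ Γ δ Γ' δ'} (π : SHA Λ Γ δ) (π' : SHA Λ Γ' δ') → (∀ n → H n π ≡ H n π') → Step π' → Step π
step-unary π π' eq ih n n< = step-≡ (eq n) (eq (suc n)) (ih n n<)

module _ {Λ Γ δ Γ₁ δ₁ Γ₂ δ₂} (π : SHA Λ Γ δ) (π₁ : SHA Λ Γ₁ δ₁) (π₂ : SHA Λ Γ₂ δ₂)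
         (eq : ∀ k → H (suc k) π ≡ H (suc k) π₁ ∧ᶠ H (suc k) π₂) where

  H-binary-proj₁ : ∀ n {Δ} → HA (H n π ∷ Δ) (H n π₁)
  H-binary-proj₁ zero    = ⊤-intro
  H-binary-proj₁ (suc k) = ∧E₁ (cast (eq k) hyp₀)

  H-binary-proj₂ : ∀ n {Δ} → HA (H n π ∷ Δ) (H n π₂)
  H-binary-proj₂ zero    = ⊤-intro
  H-binary-proj₂ (suc k) = ∧E₂ (cast (eq k) hyp₀)

  step-binary : Step π₁ → Step π₂ → Step π
  step-binary ih₁ ih₂ n n< = cast (sym (eq n))
    (∧R (cut₂ (ih₁ n n<) (H-binary-proj₁ n) hyp₁) (cut₂ (ih₂ n n<) (H-binary-proj₂ n) hyp₁))

step-comp : ∀ {Λ Γ δ x} (p : x ∈ FVs Γ δ) (wf : WF Λ Γ δ) (π : SHA (Λ ∷ʳ label x ⁻ Γ δ p) Γ δ) → Step π → Step (comp p wf π)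
step-comp {Λ} p wf π ih n n< = step-≡ (H-comp p wf π n) (H-comp p wf π (suc n))
  (castˡ (cong (λ L → H n π ∷ I L ∷ []) (take-++ (suc n) Λ _ n<)) (ih n (≤-length-++ Λ _ n<)))

step-bud : ∀ {Λ Γ δ x} (p : x ∈ FVs Γ δ) (wf : WF (Λ ∷ʳ label x ⁺ Γ δ p) Γ δ) → Step (bud p wf)
step-bud {Λ} {Γ} {δ} {x} p wf n n< with H-bud p wf (suc n)
... | inj₁ eq         = cast (sym eq) ⊤-intro
... | inj₂ (eqn , eq) = cast (sym eq) (cast (cong I (take-all (suc n) Λ⁺ (≤-reflexive (sym eqn)))) hyp₁)
  where Λ⁺ = Λ ∷ʳ label x ⁺ Γ δ p

step-pop : ∀ {Λ₀ Γ δ} Λ' (π : SHA Λ₀ Γ δ) → Step π → Step (pop Λ' π)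
step-pop {Λ₀} Λ' π ih n _ = step-≡ (H-pop Λ' π n) (H-pop Λ' π (suc n)) (by-cases (length Λ₀ ≤? n))
  where
  by-cases : Dec (length Λ₀ ≤ n) → HA (H (length Λ₀ ⊓ n) π ∷ I ((Λ₀ ++ Λ') ↾ suc n) ∷ []) (H (length Λ₀ ⊓ suc n) π)
  by-cases (yes Λ₀≤n) rewrite m≤n⇒m⊓n≡m Λ₀≤n | m≤n⇒m⊓n≡m (≤-trans Λ₀≤n (n≤1+n n)) = hyp₀
  by-cases (no Λ₀≰n) with ≰⇒> Λ₀≰n
  ... | n< rewrite m≥n⇒m⊓n≡n (<⇒≤ n<) | m≥n⇒m⊓n≡n n< | take-++ (suc n) Λ₀ Λ' n< = ih n n<

module _ {Λ Γ δ} x (wf : WF Λ Γ δ) (π₀ : SHA Λ (Γ [ 𝟎 / x ]*) (δ [ 𝟎 / x ]))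
         (πₛ : SHA (Λ ⁺[ x ]) (Γ [ S (var x) / x ]*) (δ [ S (var x) / x ])) where

  private
    π = case x wf π₀ πₛ

    ≤-lengthₛ : ∀ {n} → n ≤ length Λ → n ≤ length (Λ ⁺[ x ])
    ≤-lengthₛ = subst (_ ≤_) (sym (length-⁺ x Λ))

  H-case-proj₀ : ∀ n {Δ} → x ∉ Var (Λ ↾ n) → HA (H n π ∷ Δ) (H n π₀)
  H-case-proj₀ zero    x∉ = ⊤-intro
  H-case-proj₀ (suc k) x∉ = ∧E₁ (cast (H-case-∉ x wf π₀ πₛ k x∉) hyp₀)

  H-case-projₛ : ∀ n {Δ} → x ∉ Var (Λ ↾ n) → HA (H n π ∷ Δ) (H n πₛ)
  H-case-projₛ zero    x∉ = ⊤-intro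
  H-case-projₛ (suc k) x∉ = ∧E₂ (cast (H-case-∉ x wf π₀ πₛ k x∉) hyp₀)

  H-case-split : ∀ n {Δ} → n ≤ length Λ → ∀ e → HA ((var e ≤ᶠ var x) ∷ H n π ∷ Δ) (CaseFm.Split x (H n π₀) (H n πₛ) (var e))
  H-case-split zero    _  e = CaseFm.split-∉FV x ⊤ᶠ ⊤ᶠ e (λ ()) (λ ()) ⊤-intro ⊤-intro
  H-case-split (suc k) n≤ e = by-cases (x ∈? Var (Λ ↾ suc k))
    where
    by-cases : Dec (x ∈ Var (Λ ↾ suc k)) → _
    by-cases (yes x∈) = CaseFm.caseFm-elim x _ _ e (cast (H-case-∈ x wf π₀ πₛ k x∈) hyp₁) hyp₀
    by-cases (no x∉)  = CaseFm.split-∉FV x _ _ e (x∉ ∘ fv-H π₀ (suc k) n≤)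
      (x∉ ∘ subst (x ∈_) (Var-⁺-↾ x (suc k) Λ) ∘ fv-H πₛ (suc k) (≤-lengthₛ n≤))
      (weaken₁ (H-case-proj₀ (suc k) x∉)) (weaken₁ (H-case-projₛ (suc k) x∉))

  step-case : Step π₀ → Step πₛ → Step π
  step-case ih₀ ihₛ n n< = by-cases (x ∈? Var L)
    where
    L = Λ ↾ suc n
    ihₛ′ : HA (H n πₛ ∷ I (L ⁺[ x ]) ∷ []) (H (suc n) πₛ)
    ihₛ′ = castˡ (cong (λ L′ → H n πₛ ∷ I L′ ∷ []) (take-map (suc n) Λ)) (ihₛ n (≤-lengthₛ n<))
    by-cases : Dec (x ∈ Var L) → HA (H n π ∷ I L ∷ []) (H (suc n) π)
    by-cases (no x∉) = cast (sym (H-case-∉ x wf π₀ πₛ n x∉))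
      (∧R (cut₂ (ih₀ n n<) (H-case-proj₀ n x∉′) hyp₁)
          (cut₂ (castˡ (cong (λ L′ → H n πₛ ∷ I L′ ∷ []) (⁺-∉Var x L x∉)) ihₛ′) (H-case-projₛ n x∉′) hyp₁))
      where
      x∉′ : x ∉ Var (Λ ↾ n)
      x∉′ = x∉ ∘ Var-↾-⊆ Λ (n≤1+n n)
    by-cases (yes x∈) = cast (sym (H-case-∈ x wf π₀ πₛ n x∈)) (CaseFm.caseFm-intro x _ _ λ e →
      CaseFm.split-elim x _ _ e (H-case-split n (<⇒≤ n<) e)
        (CaseFm.split-zero x _ _ hyp₀ (cut₂ (HA-[/] (var e) x (ih₀ n n<)) hyp₁ (lower (downClosed-I L x) hyp₄ hyp₂)))
        (λ f → CaseFm.split-suc x _ _ f hyp₀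
          (cut₂ (HA-[/] (var f) x ihₛ′) hyp₁ (I-⁺-shift L x f x∈ hyp₄ (≤ᶠ-respˡ-≐ hyp₂ hyp₀)))))

step-H : ∀ {Λ Γ δ} (π : SHA Λ Γ δ) → Step π
step-H = sha-induction record
  { on-trivial = step-trivial
  ; on-unary   = step-unary
  ; on-binary  = step-binary
  ; on-comp    = step-comp
  ; on-bud     = step-bud
  ; on-pop     = step-pop
  ; on-case    = step-case
  }

lemma4p2 : ∀ {Λ Γ δ} (π : SHA Λ Γ δ) (n : ℕ) → n ≤ length Λ →
    (FV (H n π) ⊆ Var (Λ ↾ n))
    × (∀ (x y : ℕ) → HA (H n π ∷ (var x ≤ᶠ var y) ∷ []) (H n π [ var x / y ]))
    × (n < length Λ → HA (H n π ∷ I (Λ ↾ suc n) ∷ []) (H (suc n) π))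
lemma4p2 π n n≤ = fv-H π n n≤ , (λ x y → downClosed-H π n y x) , step-H π n
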